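{- For every $C>1$ there are $\varepsilon>0$ and $n_C\in\mathbb N$ such that the following holds. If $G=(V_1,V_2,E)$ is a $C$-bipartite-Ramsey graph with $|V_1|\ge|V_2|/2\ge n_C$, then either $V_1$ contains an $\varepsilon$-pair-star of size $|V_1|^{0.5}$, or $V_1$ contains an $\varepsilon$-pair-matching of size $|V_1|^{0.5}$.
   Context: A bipartite graph $G=(V_1,V_2,E)$ has disjoint finite vertex classes $V_1,V_2$ and edge set $E\subset V_1\times V_2$; $N(v)$ is the neighbourhood and $d(v)=|N(v)|$. Given $C>0$, $G$ is $C$-bipartite-Ramsey if for all integers $t_1\ge C\log_2|V_1|$ and $t_2\ge C\log_2|V_2|$ there are no $T_1\subset V_1$, $T_2\subset V_2$ with $|T_1|=t_1$, $|T_2|=t_2$ such that either all pairs of $T_1\times T_2$ are edges or none are. Let $\mathrm{div}(u,v)=N(u)\triangle N(v)$. An ordered pair $\mathbf p=(x,y)$ of distinct vertices is taken with the convention $|N(x)\setminus N(y)|\ge|N(y)\setminus N(x)|$; set $\mathrm{divb}(\mathbf p)=N(x)\setminus N(y)$ and $\mathrm{dd}(\mathbf p)=d(x)-d(y)$. An $\varepsilon$-pair-star of size $k$ (associated to $V_1$) is a set $\{x_0,x_1,\ldots,x_k\}\subset V_1$ with $|d(x_j)-d(x_0)|\le|V_2|^{0.5}$ for all $j\in[k]$ and $|\mathrm{div}(x_i,x_j)|\ge\varepsilon|V_2|$ for all distinct $i,j\in\{0,\ldots,k\}$. An $\varepsilon$-pair-matching of size $k$ (associated to $V_1$) is a collection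 of pairwise vertex-disjoint ordered pairs $\mathbf p_i=(x_i,y_i)$, $i\in[k]$, of vertices of $V_1$ with $\mathrm{dd}(\mathbf p_i)\le|V_2|^{0.5}$ for all $i$, and $|\mathrm{divb}(\mathbf p_i)\setminus N(x_j)|\ge\varepsilon|V_2|$ and $|\mathrm{divb}(\mathbf p_i)\setminus N(y_j)|\ge\varepsilon|V_2|$ for all distinct $i,j\in[k]$. Non-integer sizes such as $|V_1|^{0.5}$ are understood up to rounding.
   Formalization: The constant C ranges over the rationals greater than 1. -}

module Defs where

open import Data.Nat using (ℕ; zero; suc; _+_; _*_; _∸_; _^_; _≤_; _<_; ∣_-_∣)
open import Data.Bool using (Bool; true; false)
open import Data.Fin using (Fin)
open import Data.Fin.Subset as S using (Subset; _∩_; _∪_; _─_; ∁)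
open import Data.Vec using (tabulate)
open import Data.Product using (Σ; _×_; ∃)
open import Relation.Nullary using (¬_)
open import Relation.Binary.PropositionalEquality using (_≡_; _≢_)
open import Function.Definitions using (Injective)

BipGraph : ℕ → ℕ → Set
BipGraph n₁ n₂ = Fin n₁ → Fin n₂ → Bool

module _ {n₁ n₂ : ℕ} (G : BipGraph n₁ n₂) where

  N : Fin n₁ → Subset n₂
  N v = tabulate (G v)

  deg : Fin n₁ → ℕ
  deg v = S.∣ N v ∣

  div : Fin n₁ → Fin n₁ → Subset n₂
  div u v = (N u ─ N v) ∪ (N v ─ N u)

  divb : Fin n₁ → Fin n₁ → Subset n₂
  divb x y = N x ─ N y

  PairConvention : Fin n₁ → Fin n₁ → Set
  PairConvention x y = S.∣ N y ─ N x ∣ ≤ S.∣ N x ─ N y ∣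

  -- |A| ≥ ε|V₂| with ε = a/b (b > 0), written as b·|A| ≥ a·n₂
  AtLeastεV₂ : (a b : ℕ) → Subset n₂ → Set
  AtLeastεV₂ a b A = a * n₂ ≤ b * S.∣ A ∣

  -- ε-pair-star of size k associated to V₁, ε = a/b.
  -- The star is an injective family x : Fin (k+1) → V₁ with x₀ = x zero.
  -- |d(x_j) − d(x_0)| ≤ |V₂|^{0.5}  is written  |d(x_j) − d(x_0)|² ≤ n₂.
  PairStar : (a b k : ℕ) → Set
  PairStar a b k =
    Σ (Fin (suc k) → Fin n₁) λ x →
        Injective _≡_ _≡_ x
      × (∀ j → ∣ deg (x j) - deg (x Fin.zero) ∣ * ∣ deg (x j) - deg (x Fin.zero) ∣ ≤ n₂)
      × (∀ i j → i ≢ j → AtLeastεV₂ a b (div (x i) (x j)))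

  -- Pairs p_i = (x i, y i), pairwise vertex-disjoint (all 2k vertices distinct),
  -- each ordered by the convention; dd(p_i) = d(x_i) − d(y_i) ≤ |V₂|^{0.5} is
  -- written (d(x_i) ∸ d(y_i))² ≤ n₂ (trivially true when dd(p_i) ≤ 0).
  PairMatching : (a b k : ℕ) → Set
  PairMatching a b k =
    Σ (Fin k → Fin n₁) λ x → Σ (Fin k → Fin n₁) λ y →
        Injective _≡_ _≡_ x
      × Injective _≡_ _≡_ y
      × (∀ i j → x i ≢ y j)
      × (∀ i → PairConvention (x i) (y i))
      × (∀ i → (deg (x i) ∸ deg (y i)) * (deg (x i) ∸ deg (y i)) ≤ n₂)
      × (∀ i j → i ≢ j → AtLeastεV₂ a b (divb (x i) (y i) ─ N (x j))
                        × AtLeastεV₂ a b (divb (x i) (y i) ─ N (y j)))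

  -- C-bipartite-Ramsey with C = p/q (q > 0).  Since C > 0,
  --   t ≥ (p/q)·log₂ n  ⇔  2^(q·t) ≥ n^p   (for n ≥ 1).
  -- T₁ × T₂ is complete: all pairs edges; empty: no pair is an edge.
  Complete : Subset n₁ → Subset n₂ → Set
  Complete T₁ T₂ = ∀ u v → u S.∈ T₁ → v S.∈ T₂ → G u v ≡ true

  Empty : Subset n₁ → Subset n₂ → Set
  Empty T₁ T₂ = ∀ u v → u S.∈ T₁ → v S.∈ T₂ → G u v ≡ false

  BipRamsey : (p q : ℕ) → Set
  BipRamsey p q =
    ∀ (t₁ t₂ : ℕ) → n₁ ^ p ≤ 2 ^ (q * t₁) → n₂ ^ p ≤ 2 ^ (q * t₂) →
    ∀ (T₁ : Subset n₁) (T₂ : Subset n₂) → S.∣ T₁ ∣ ≡ t₁ → S.∣ T₂ ∣ ≡ t₂ →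
    ¬ (Complete T₁ T₂) × ¬ (Empty T₁ T₂)

-- Write L = 16p + 1 and ε = 1/(16L²); we always find an ε-pair-matching.
-- The Ramsey property forbids complete and empty t₁ × t₂ bicliques, where tᵢ = 8p⌈log₂₅₆ nᵢ⌉. Growing a
-- complete biclique greedily, each time adding a vertex of D ⊆ V₂ adjacent to a (1 − 1/L)-fraction of the
-- current side, shows that fewer than B = t₁ 2^⌈log₂₅₆ n₂⌉ vertices of V₁ miss fewer than |D| / 2L vertices
-- of D each, whenever |D| ≥ 2t₂. With D = N(u) (or V₂ ∖ N(u) in the complement) this bounds the number of
-- vertices v with |div(u,v)| < n₂ / 4L by B; with D = divb(x,y) it bounds the number of vertices v blocking
-- the pair (x,y), i.e. with |divb(x,y) ∖ N(v)| < εn₂. Grouping V₁ by ⌊d(v) / √n₂⌋ and greedily pairing far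
-- apart vertices inside each group leaves fewer than B vertices per group unpaired, so we get nearly n₁/2
-- disjoint pairs with degree difference below √n₂. Each pair is blocked by fewer than 2B endpoints of other
-- pairs, so repeatedly keeping a pair of minimum conflict degree selects a (4B+1)-th of them without any
-- conflicts; as B ≤ √n₁/20, that is at least √n₁ pairs, and they form an ε-pair-matching.

module Submission where

open import Defs
open import Data.Bool using (Bool; true; false; not; _∧_; _∨_; T?)
open import Data.Bool.Properties as Boolₚ using (T-≡; ¬-not)
open import Data.Empty using (⊥; ⊥-elim)
open import Data.Fin using (Fin; zero; suc; inject≤)
import Data.Fin.Properties as Finₚ
open import Data.Fin.Subset as Subset using (Subset; _─_; _∪_)
open import Data.Fin.Subset.Properties using (∣p∣≤n)
open import Data.List using (List; []; _∷_; _++_; length; map; filterᵇ; lookup; allFin; tabulate; take; upTo)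
open import Data.List.Membership.Propositional using (_∈_; _∉_; find)
open import Data.List.Membership.Propositional.Properties
  using (∈-filter⁻; ∈-length; ∈-lookup; ∈-map⁻; ∈-allFin; ∈-++⁻; ∈-upTo⁺)
import Data.List.Membership.DecPropositional as DecMembership
open import Data.List.Properties using (length-take; length-tabulate; map-tabulate; length-++; length-upTo)
open import Data.List.Relation.Binary.Disjoint.Propositional using (Disjoint)
open import Data.List.Relation.Binary.Sublist.Propositional.Properties using (take-⊆; Any-resp-⊆)
open import Data.List.Relation.Binary.Subset.Propositional using (_⊆_)
open import Data.List.Relation.Unary.All as All using (All; []; _∷_)
import Data.List.Relation.Unary.All.Properties as Allₚ
open import Data.List.Relation.Unary.AllPairs using (AllPairs; []; _∷_)
open import Data.List.Relation.Unary.Any using (here; there; any?)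
open import Data.List.Relation.Unary.Unique.Propositional using (Unique)
open import Data.List.Relation.Unary.Unique.Propositional.Properties as Uniqueₚ using (allFin⁺; upTo⁺; take⁺)
open import Data.Nat using (ℕ; zero; suc; _+_; _*_; _∸_; _^_; _≤_; _<_; z≤n; s≤s; NonZero; >-nonZero)
open import Data.Nat.DivMod using (_/_; _%_; m/n*n≤m; m%n≡m∸m/n*n; m%n<n; m<n*o⇒m/o<n)
open import Data.Nat.ListAction using (sum)
open import Data.Nat.Properties
open import Data.Nat.Tactic.RingSolver using (solve-∀)
open import Data.Product using (Σ; ∃; _×_; _,_; proj₁; proj₂)
open import Data.Product.Properties using (≡-dec)
open import Data.Sum using (_⊎_; inj₁; inj₂)
open import Data.Vec as Vec using ([]; _∷_)
open import Data.Vec.Properties using (lookup∘tabulate; lookup-zipWith; []=⇒lookup)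
open import Function using (_∘_; Equivalence)
open import Relation.Binary.Definitions using (DecidableEquality)
open import Relation.Binary.PropositionalEquality
open import Relation.Nullary using (¬_; Dec; yes; no; does)

does-true : {P : Set} (d : Dec P) → does d ≡ true → P
does-true (yes p) _ = p

does-false : {P : Set} (d : Dec P) → does d ≡ false → ¬ P
does-false (no ¬p) _ = ¬p

-- Sums and counts over lists

indicator : Bool → ℕ
indicator true  = 1
indicator false = 0

module _ {A : Set} where

  ∑ : List A → (A → ℕ) → ℕ
  ∑ xs g = sum (map g xs)

  syntax ∑ xs (λ x → e) = ∑[ x ∈ xs ] e

  count : (A → Bool) → List A → ℕ
  count f xs = ∑[ x ∈ xs ] indicator (f x)

  ∑-cong : {g h : A → ℕ} → (∀ x → g x ≡ h x) → ∀ xs → ∑ xs g ≡ ∑ xs h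
  ∑-cong g≗h []       = refl
  ∑-cong g≗h (x ∷ xs) = cong₂ _+_ (g≗h x) (∑-cong g≗h xs)

  ∑-mono : {g h : A → ℕ} (xs : List A) → (∀ x → x ∈ xs → g x ≤ h x) → ∑ xs g ≤ ∑ xs h
  ∑-mono []       g≤h = z≤n
  ∑-mono (x ∷ xs) g≤h = +-mono-≤ (g≤h x (here refl)) (∑-mono xs (λ y y∈ → g≤h y (there y∈)))

  ∑-+ : (g h : A → ℕ) (xs : List A) → ∑[ x ∈ xs ] (g x + h x) ≡ ∑ xs g + ∑ xs h
  ∑-+ g h []       = refl
  ∑-+ g h (x ∷ xs) = trans (cong (g x + h x +_) (∑-+ g h xs)) (interchange (g x) (h x) (∑ xs g) (∑ xs h))
    where
    interchange : ∀ a b c d → a + b + (c + d) ≡ a + c + (b + d)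
    interchange = solve-∀

  ∑-const : (c : ℕ) (xs : List A) → ∑[ x ∈ xs ] c ≡ length xs * c
  ∑-const c []       = refl
  ∑-const c (x ∷ xs) = cong (c +_) (∑-const c xs)

  ∑-zero : (xs : List A) → ∑[ x ∈ xs ] 0 ≡ 0
  ∑-zero xs = trans (∑-const 0 xs) (*-zeroʳ (length xs))

  ∑-*ˡ : (c : ℕ) (g : A → ℕ) (xs : List A) → ∑[ x ∈ xs ] (c * g x) ≡ c * ∑ xs g
  ∑-*ˡ c g []       = sym (*-zeroʳ c)
  ∑-*ˡ c g (x ∷ xs) = trans (cong (c * g x +_) (∑-*ˡ c g xs)) (sym (*-distribˡ-+ c (g x) (∑ xs g)))

  ∃-≥-average : (g : A → ℕ) (xs : List A) → 0 < length xs → ∃ λ x → x ∈ xs × ∑ xs g ≤ length xs * g x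
  ∃-≥-average g (x ∷ [])     _ = x , here refl , ≤-reflexive (cong (g x +_) (sym (*-zeroʳ 0)))
  ∃-≥-average g (x ∷ y ∷ xs) _ with ∃-≥-average g (y ∷ xs) (s≤s z≤n)
  ... | z , z∈ , avg≤gz with g x ≤? g z
  ...   | yes gx≤gz = z , there z∈ , +-mono-≤ gx≤gz avg≤gz
  ...   | no  gx≰gz = x , here refl , +-monoʳ-≤ (g x) (≤-trans avg≤gz (*-monoʳ-≤ (length (y ∷ xs)) (≰⇒≥ gx≰gz)))

  ∃-≤-average : (g : A → ℕ) (xs : List A) → 0 < length xs → ∃ λ x → x ∈ xs × length xs * g x ≤ ∑ xs g
  ∃-≤-average g (x ∷ [])     _ = x , here refl , ≤-reflexive (cong (g x +_) (*-zeroʳ 0))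
  ∃-≤-average g (x ∷ y ∷ xs) _ with ∃-≤-average g (y ∷ xs) (s≤s z≤n)
  ... | z , z∈ , gz≤avg with g z ≤? g x
  ...   | yes gz≤gx = z , there z∈ , +-mono-≤ gz≤gx gz≤avg
  ...   | no  gz≰gx = x , here refl , +-monoʳ-≤ (g x) (≤-trans (*-monoʳ-≤ (length (y ∷ xs)) (≰⇒≥ gz≰gx)) gz≤avg)

  ∈-filterᵇ⁻ : (f : A → Bool) (xs : List A) {x : A} → x ∈ filterᵇ f xs → x ∈ xs × f x ≡ true
  ∈-filterᵇ⁻ f xs x∈ with ∈-filter⁻ (λ y → T? (f y)) {xs = xs} x∈
  ... | x∈xs , fx = x∈xs , Equivalence.to T-≡ fx

  filterᵇ-unique : (f : A → Bool) {xs : List A} → Unique xs → Unique (filterᵇ f xs)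
  filterᵇ-unique f = Uniqueₚ.filter⁺ (λ y → T? (f y))

  length-filterᵇ : (f : A → Bool) (xs : List A) → length (filterᵇ f xs) ≡ count f xs
  length-filterᵇ f []       = refl
  length-filterᵇ f (x ∷ xs) with f x
  ... | true  = cong suc (length-filterᵇ f xs)
  ... | false = length-filterᵇ f xs

  count-filterᵇ : (f g : A → Bool) (xs : List A) → count f (filterᵇ g xs) ≡ count (λ x → g x ∧ f x) xs
  count-filterᵇ f g []       = refl
  count-filterᵇ f g (x ∷ xs) with g x
  ... | true  = cong (indicator (f x) +_) (count-filterᵇ f g xs)
  ... | false = count-filterᵇ f g xs

  count-filterᵇ-≤ : (f g : A → Bool) (xs : List A) → count f (filterᵇ g xs) ≤ count f xs
  count-filterᵇ-≤ f g []       = z≤n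
  count-filterᵇ-≤ f g (x ∷ xs) with g x
  ... | true  = +-monoʳ-≤ (indicator (f x)) (count-filterᵇ-≤ f g xs)
  ... | false = m≤n⇒m≤o+n (indicator (f x)) (count-filterᵇ-≤ f g xs)

  count-≤-length : (f : A → Bool) (xs : List A) → count f xs ≤ length xs
  count-≤-length f []       = z≤n
  count-≤-length f (x ∷ xs) with f x
  ... | true  = s≤s (count-≤-length f xs)
  ... | false = m≤n⇒m≤1+n (count-≤-length f xs)

  count-<-length : (f : A → Bool) {x : A} {xs : List A} → x ∈ xs → f x ≡ false → count f xs < length xs
  count-<-length f {xs = y ∷ xs} (here refl) fx rewrite fx = s≤s (count-≤-length f xs)
  count-<-length f {xs = y ∷ xs} (there x∈) fx with f y
  ... | true  = s≤s (count-<-length f x∈ fx)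
  ... | false = m<n⇒m<1+n (count-<-length f x∈ fx)

  count-+-count-not : (f : A → Bool) (xs : List A) → count f xs + count (not ∘ f) xs ≡ length xs
  count-+-count-not f []       = refl
  count-+-count-not f (x ∷ xs) with f x
  ... | true  = cong suc (count-+-count-not f xs)
  ... | false = trans (+-suc _ _) (cong suc (count-+-count-not f xs))

  count-cong : {f g : A → Bool} → (∀ x → f x ≡ g x) → (xs : List A) → count f xs ≡ count g xs
  count-cong f≗g = ∑-cong (cong indicator ∘ f≗g)

  count-∨ : (f g : A → Bool) (xs : List A) → count (λ x → f x ∨ g x) xs ≤ count f xs + count g xs
  count-∨ f g xs = ≤-trans (∑-mono xs (λ x _ → indicator-∨ (f x) (g x))) (≤-reflexive (∑-+ _ _ xs))
    where
    indicator-∨ : ∀ a b → indicator (a ∨ b) ≤ indicator a + indicator b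
    indicator-∨ true  b = s≤s z≤n
    indicator-∨ false b = ≤-refl

  count-∨-disjoint : (f g : A → Bool) (xs : List A) → (∀ x → f x ≡ true → g x ≡ true → ⊥) →
                     count (λ x → f x ∨ g x) xs ≡ count f xs + count g xs
  count-∨-disjoint f g xs disjoint = trans (∑-cong indicator-∨ xs) (∑-+ _ _ xs)
    where
    indicator-∨ : ∀ x → indicator (f x ∨ g x) ≡ indicator (f x) + indicator (g x)
    indicator-∨ x with f x | g x | disjoint x
    ... | true  | true  | ¬both = ⊥-elim (¬both refl refl)
    ... | true  | false | _     = refl
    ... | false | _     | _     = refl

∑-swap : {A B : Set} (h : A → B → ℕ) (xs : List A) (ys : List B) →
         ∑[ x ∈ xs ] ∑[ y ∈ ys ] h x y ≡ ∑[ y ∈ ys ] ∑[ x ∈ xs ] h x y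
∑-swap h []       ys = sym (∑-zero ys)
∑-swap h (x ∷ xs) ys = trans (cong (∑ ys (h x) +_) (∑-swap h xs ys)) (sym (∑-+ (h x) _ ys))

count-map : {A B : Set} (f : B → Bool) (g : A → B) (xs : List A) → count f (map g xs) ≡ count (f ∘ g) xs
count-map f g []       = refl
count-map f g (x ∷ xs) = cong (indicator (f (g x)) +_) (count-map f g xs)

module _ {A : Set} (_≟_ : DecidableEquality A) where

  open DecMembership _≟_ using (_∈?_)

  count-≟-∉ : ∀ x (xs : List A) → x ∉ xs → count (λ y → does (y ≟ x)) xs ≡ 0
  count-≟-∉ x []       _   = refl
  count-≟-∉ x (y ∷ xs) x∉ with y ≟ x
  ... | yes refl = ⊥-elim (x∉ (here refl))
  ... | no  _    = count-≟-∉ x xs (x∉ ∘ there)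

  count-≟ : ∀ x {xs : List A} → Unique xs → x ∈ xs → count (λ y → does (y ≟ x)) xs ≡ 1
  count-≟ x {y ∷ xs} (y∉xs ∷ xs!) x∈ with y ≟ x | x∈
  ... | yes refl | _          = cong suc (count-≟-∉ x xs (Allₚ.All¬⇒¬Any y∉xs))
  ... | no  y≢x  | here x≡y   = ⊥-elim (y≢x (sym x≡y))
  ... | no  _    | there x∈xs = count-≟ x xs! x∈xs

  count-∈? : {ys : List A} → Unique ys → (xs : List A) → Unique xs → ys ⊆ xs →
             count (λ x → does (x ∈? ys)) xs ≡ length ys
  count-∈? {[]}     _            xs _   _   = ∑-zero xs
  count-∈? {y ∷ ys} (y∉ys ∷ ys!) xs xs! y∷ys⊆ = begin
    count (λ x → does (x ≟ y) ∨ does (x ∈? ys)) xs      ≡⟨ count-∨-disjoint _ _ xs y∉ ⟩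
    count (λ x → does (x ≟ y)) xs + count (λ x → does (x ∈? ys)) xs
      ≡⟨ cong₂ _+_ (count-≟ y xs! (y∷ys⊆ (here refl))) (count-∈? ys! xs xs! (y∷ys⊆ ∘ there)) ⟩
    suc (length ys)                                      ∎
    where
    open ≡-Reasoning
    y∉ : ∀ x → does (x ≟ y) ≡ true → does (x ∈? ys) ≡ true → ⊥
    y∉ x x≡y x∈ys with does-true (x ≟ y) x≡y
    ... | refl = Allₚ.All¬⇒¬Any y∉ys (does-true (x ∈? ys) x∈ys)

  remove : A → List A → List A
  remove x = filterᵇ (λ y → not (does (y ≟ x)))

  remove-⊆ : ∀ x (xs : List A) → remove x xs ⊆ xs
  remove-⊆ x xs = proj₁ ∘ ∈-filterᵇ⁻ _ xs

  remove-∉ : ∀ x (xs : List A) → x ∉ remove x xs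
  remove-∉ x xs x∈ with x ≟ x | proj₂ (∈-filterᵇ⁻ (λ y → not (does (y ≟ x))) xs x∈)
  ... | no x≢x | _ = x≢x refl

  remove-unique : ∀ x {xs : List A} → Unique xs → Unique (remove x xs)
  remove-unique x = filterᵇ-unique _

  length-remove : ∀ x {xs : List A} → Unique xs → x ∈ xs → suc (length (remove x xs)) ≡ length xs
  length-remove x {xs} xs! x∈ = begin
    suc (length (remove x xs))                                          ≡⟨ cong (_+ length (remove x xs)) (count-≟ x xs! x∈) ⟨
    count (λ y → does (y ≟ x)) xs + length (remove x xs)                ≡⟨ cong (count _ xs +_) (length-filterᵇ _ xs) ⟩
    count (λ y → does (y ≟ x)) xs + count (λ y → not (does (y ≟ x))) xs ≡⟨ count-+-count-not _ xs ⟩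
    length xs                                                           ∎
    where open ≡-Reasoning

AllPairs-lookup : {A : Set} {R : A → A → Set} → (∀ {x y} → R x y → R y x) →
                  ∀ {xs} → AllPairs R xs → ∀ {i j} → i ≢ j → R (lookup xs i) (lookup xs j)
AllPairs-lookup R-sym (_ ∷ _)   {zero}  {zero}  i≢j = ⊥-elim (i≢j refl)
AllPairs-lookup R-sym (px ∷ _)  {zero}  {suc j} _   = All.lookup px (∈-lookup j)
AllPairs-lookup R-sym (px ∷ _)  {suc i} {zero}  _   = R-sym (All.lookup px (∈-lookup i))
AllPairs-lookup R-sym (_ ∷ pxs) {suc i} {suc j} i≢j = AllPairs-lookup R-sym pxs (i≢j ∘ cong suc)

module _ {A : Set} where

  endpoints : List (A × A) → List A
  endpoints []             = []
  endpoints ((x , y) ∷ ps) = x ∷ y ∷ endpoints ps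

  endpoints-++ : (ps qs : List (A × A)) → endpoints (ps ++ qs) ≡ endpoints ps ++ endpoints qs
  endpoints-++ []             qs = refl
  endpoints-++ ((x , y) ∷ ps) qs = cong (λ zs → x ∷ y ∷ zs) (endpoints-++ ps qs)

  proj₁-∈-endpoints : {p : A × A} {ps : List (A × A)} → p ∈ ps → proj₁ p ∈ endpoints ps
  proj₁-∈-endpoints {ps = (x , y) ∷ ps} (here refl) = here refl
  proj₁-∈-endpoints {ps = (x , y) ∷ ps} (there p∈) = there (there (proj₁-∈-endpoints p∈))

  proj₂-∈-endpoints : {p : A × A} {ps : List (A × A)} → p ∈ ps → proj₂ p ∈ endpoints ps
  proj₂-∈-endpoints {ps = (x , y) ∷ ps} (here refl) = there (here refl)
  proj₂-∈-endpoints {ps = (x , y) ∷ ps} (there p∈) = there (there (proj₂-∈-endpoints p∈))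

  unique-cons₂ : ∀ {x y : A} {zs} → x ≢ y → x ∉ zs → y ∉ zs → Unique zs → Unique (x ∷ y ∷ zs)
  unique-cons₂ x≢y x∉ y∉ zs! = (x≢y ∷ Allₚ.¬Any⇒All¬ _ x∉) ∷ Allₚ.¬Any⇒All¬ _ y∉ ∷ zs!

  private
    ∉-map : ∀ {z : A} (f : A × A → A) {ps} → (∀ {p} → p ∈ ps → f p ∈ endpoints ps) →
            z ∉ endpoints ps → z ∉ map f ps
    ∉-map f {ps} f∈ z∉ z∈ with ∈-map⁻ f z∈
    ... | p , p∈ , refl = z∉ (f∈ p∈)

  unique-map-proj₁ : (ps : List (A × A)) → Unique (endpoints ps) → Unique (map proj₁ ps)
  unique-map-proj₁ []             _                      = []
  unique-map-proj₁ ((x , y) ∷ ps) ((_ ∷ x∉) ∷ _ ∷ ps!) =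
    Allₚ.¬Any⇒All¬ _ (∉-map proj₁ proj₁-∈-endpoints (Allₚ.All¬⇒¬Any x∉)) ∷ unique-map-proj₁ ps ps!

  unique-map-proj₂ : (ps : List (A × A)) → Unique (endpoints ps) → Unique (map proj₂ ps)
  unique-map-proj₂ []             _                    = []
  unique-map-proj₂ ((x , y) ∷ ps) (_ ∷ y∉ ∷ ps!) =
    Allₚ.¬Any⇒All¬ _ (∉-map proj₂ proj₂-∈-endpoints (Allₚ.All¬⇒¬Any y∉)) ∷ unique-map-proj₂ ps ps!

  private
    head-fresh : ∀ {x y v : A} {ps} → Unique (x ∷ y ∷ endpoints ps) → v ∈ x ∷ y ∷ [] → v ∉ endpoints ps
    head-fresh ((_ ∷ x∉) ∷ _)  (here refl)         = Allₚ.All¬⇒¬Any x∉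
    head-fresh (_ ∷ y∉ ∷ _)    (there (here refl)) = Allₚ.All¬⇒¬Any y∉

    ∈-endpoints-[_] : {v : A} {q : A × A} {ps : List (A × A)} → v ∈ endpoints (q ∷ []) → q ∈ ps → v ∈ endpoints ps
    ∈-endpoints-[ here refl ]         q∈ = proj₁-∈-endpoints q∈
    ∈-endpoints-[ there (here refl) ] q∈ = proj₂-∈-endpoints q∈

  endpoints-unique⇒unique : (ps : List (A × A)) → Unique (endpoints ps) → Unique ps
  endpoints-unique⇒unique []             _                   = []
  endpoints-unique⇒unique ((x , y) ∷ ps) ((_ ∷ x∉) ∷ _ ∷ ps!) =
    All.tabulate (λ { q∈ refl → Allₚ.All¬⇒¬Any x∉ (proj₁-∈-endpoints q∈) }) ∷ endpoints-unique⇒unique ps ps!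

  endpoints-distinct : {ps : List (A × A)} → Unique (endpoints ps) → ∀ {p} → p ∈ ps → proj₁ p ≢ proj₂ p
  endpoints-distinct {(x , y) ∷ ps} ((x≢y ∷ _) ∷ _)   (here refl) = x≢y
  endpoints-distinct {(x , y) ∷ ps} (_ ∷ _ ∷ ps!)     (there p∈)  = endpoints-distinct ps! p∈

  endpoints-disjoint : {ps : List (A × A)} → Unique (endpoints ps) → ∀ {p q} → p ∈ ps → q ∈ ps → p ≢ q →
                       Disjoint (endpoints (p ∷ [])) (endpoints (q ∷ []))
  endpoints-disjoint {(x , y) ∷ ps} _ (here refl) (here refl) p≢q _ = p≢q refl
  endpoints-disjoint {(x , y) ∷ ps} ps! (here refl) (there q∈) _ (v∈p , v∈q) =
    head-fresh ps! v∈p (∈-endpoints-[ v∈q ] q∈)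
  endpoints-disjoint {(x , y) ∷ ps} ps! (there p∈) (here refl) _ (v∈p , v∈q) =
    head-fresh ps! v∈q (∈-endpoints-[ v∈p ] p∈)
  endpoints-disjoint {(x , y) ∷ ps} (_ ∷ _ ∷ ps!) (there p∈) (there q∈) p≢q =
    endpoints-disjoint ps! p∈ q∈ p≢q

-- Greedy matchings and greedy independent sets

module GreedyMatching {A : Set} (_≟_ : DecidableEquality A) (far : A → A → Bool) (B : ℕ)
  (few-close : ∀ u (vs : List A) → Unique vs → All (λ v → far u v ≡ false) vs → length vs < B)
  (Good : A × A → Set) where

  Matching : List A → Set
  Matching xs = ∃ λ ps → Unique (endpoints ps) × endpoints ps ⊆ xs × All Good ps × length xs ≤ 2 * length ps + B

  greedy-matching : (xs : List A) → Unique xs →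
                    (∀ {u v} → u ∈ xs → v ∈ xs → far u v ≡ true → Good (u , v) ⊎ Good (v , u)) → Matching xs
  greedy-matching xs = go (length xs) xs ≤-refl
    where
    go : ∀ n xs → length xs ≤ n → Unique xs →
         (∀ {u v} → u ∈ xs → v ∈ xs → far u v ≡ true → Good (u , v) ⊎ Good (v , u)) → Matching xs
    go n       []         _ _ _ = [] , [] , (λ ()) , [] , z≤n
    go zero    (u ∷ rest) () _ _
    go (suc n) (u ∷ rest) (s≤s len≤) (u∉ ∷ rest!) orient with any? (λ v → far u v Boolₚ.≟ true) rest
    ... | no none = [] , [] , (λ ()) , [] ,
                    few-close u rest rest! (All.map (λ fuv → ¬-not fuv) (Allₚ.¬Any⇒All¬ rest none))
    ... | yes some with find some
    ...   | v , v∈ , fuv with go n (remove _≟_ v rest) len≤′ (remove-unique _≟_ v rest!) orient′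
      where
      len≤′ : length (remove _≟_ v rest) ≤ n
      len≤′ = ≤-trans (n≤1+n _) (≤-trans (≤-reflexive (length-remove _≟_ v rest! v∈)) len≤)
      orient′ : ∀ {a b} → a ∈ remove _≟_ v rest → b ∈ remove _≟_ v rest → far a b ≡ true → Good (a , b) ⊎ Good (b , a)
      orient′ a∈ b∈ = orient (there (remove-⊆ _≟_ v rest a∈)) (there (remove-⊆ _≟_ v rest b∈))
    ...     | ps , ps! , ps⊆ , good , len = pair (orient (here refl) (there v∈) fuv)
      where
      u≢v : u ≢ v
      u≢v = All.lookup u∉ v∈
      u∉ps : u ∉ endpoints ps
      u∉ps u∈ = Allₚ.All¬⇒¬Any u∉ (remove-⊆ _≟_ v rest (ps⊆ u∈))
      v∉ps : v ∉ endpoints ps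
      v∉ps v∈ = remove-∉ _≟_ v rest (ps⊆ v∈)
      ps⊆u∷rest : endpoints ps ⊆ u ∷ rest
      ps⊆u∷rest = there ∘ remove-⊆ _≟_ v rest ∘ ps⊆
      len′ : length (u ∷ rest) ≤ 2 * suc (length ps) + B
      len′ = begin
        suc (length rest)                        ≡⟨ cong suc (length-remove _≟_ v rest! v∈) ⟨
        suc (suc (length (remove _≟_ v rest)))   ≤⟨ s≤s (s≤s len) ⟩
        suc (suc (2 * length ps + B))            ≡⟨ two-more (length ps) B ⟩
        2 * suc (length ps) + B                  ∎
        where
        open ≤-Reasoning
        two-more : ∀ a b → suc (suc (2 * a + b)) ≡ 2 * suc a + b
        two-more = solve-∀
      pair : Good (u , v) ⊎ Good (v , u) → Matching (u ∷ rest)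
      pair (inj₁ good-uv) = (u , v) ∷ ps , unique-cons₂ u≢v u∉ps v∉ps ps! ,
        (λ { (here refl) → here refl ; (there (here refl)) → there v∈ ; (there (there w∈)) → ps⊆u∷rest w∈ }) ,
        good-uv ∷ good , len′
      pair (inj₂ good-vu) = (v , u) ∷ ps , unique-cons₂ (u≢v ∘ sym) v∉ps u∉ps ps! ,
        (λ { (here refl) → there v∈ ; (there (here refl)) → here refl ; (there (there w∈)) → ps⊆u∷rest w∈ }) ,
        good-vu ∷ good , len′

module GreedyIndependentSet {A : Set} (_≟_ : DecidableEquality A) (conflict : A → A → Bool) (D : ℕ) where

  Compatible : A → A → Set
  Compatible p q = conflict p q ≡ false × conflict q p ≡ false × p ≢ q

  Independent : List A → Set
  Independent xs = ∃ λ cs → cs ⊆ xs × AllPairs Compatible cs × length xs ≤ (2 * D + 1) * length cs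

  OutDegreeBounded : List A → Set
  OutDegreeBounded xs = ∀ {p} → p ∈ xs → count (conflict p) xs ≤ D

  degree : List A → A → ℕ
  degree xs p = count (conflict p) xs + count (λ q → conflict q p) xs

  -- each conflict is counted once as an out-edge and once as an in-edge
  ∑-degree : (xs : List A) → OutDegreeBounded xs → ∑ xs (degree xs) ≤ length xs * (2 * D)
  ∑-degree xs bounded = begin
    ∑ xs (degree xs)                                                        ≡⟨ ∑-+ _ _ xs ⟩
    ∑[ p ∈ xs ] count (conflict p) xs + ∑[ p ∈ xs ] count (λ q → conflict q p) xs
      ≡⟨ cong (∑[ p ∈ xs ] count (conflict p) xs +_) (∑-swap (λ p q → indicator (conflict q p)) xs xs) ⟩
    ∑[ p ∈ xs ] count (conflict p) xs + ∑[ p ∈ xs ] count (conflict p) xs  ≤⟨ +-mono-≤ out out ⟩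
    length xs * D + length xs * D                                          ≡⟨ double (length xs) D ⟩
    length xs * (2 * D)                                                    ∎
    where
    open ≤-Reasoning
    double : ∀ a b → a * b + a * b ≡ a * (2 * b)
    double = solve-∀
    out : ∑[ p ∈ xs ] count (conflict p) xs ≤ length xs * D
    out = ≤-trans (∑-mono xs (λ p → bounded)) (≤-reflexive (∑-const D xs))

  private
    removed : A → A → Bool
    removed p q = conflict p q ∨ (conflict q p ∨ does (q ≟ p))

    removed-self : ∀ p → removed p p ≡ true
    removed-self p with p ≟ p
    ... | yes _  = trans (cong (conflict p p ∨_) (Boolₚ.∨-zeroʳ _)) (Boolₚ.∨-zeroʳ _)
    ... | no p≢p = ⊥-elim (p≢p refl)

    kept-compatible : ∀ p q → removed p q ≡ false → Compatible p q
    kept-compatible p q kept with conflict p q | conflict q p | q ≟ p | kept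
    ... | false | false | no q≢p | _ = refl , refl , q≢p ∘ sym

    count-removed : (xs : List A) → Unique xs → OutDegreeBounded xs → ∀ {p} → p ∈ xs →
                    length xs * degree xs p ≤ ∑ xs (degree xs) → count (removed p) xs ≤ 2 * D + 1
    count-removed xs xs! bounded {p} p∈ minimal = begin
      count (removed p) xs                                              ≤⟨ count-∨ _ _ xs ⟩
      count (conflict p) xs + count (λ q → conflict q p ∨ does (q ≟ p)) xs
        ≤⟨ +-monoʳ-≤ (count (conflict p) xs) (count-∨ _ _ xs) ⟩
      count (conflict p) xs + (count (λ q → conflict q p) xs + count (λ q → does (q ≟ p)) xs)
        ≡⟨ +-assoc (count (conflict p) xs) _ _ ⟨
      degree xs p + count (λ q → does (q ≟ p)) xs                       ≤⟨ +-mono-≤ degree≤ (≤-reflexive (count-≟ _≟_ p xs! p∈)) ⟩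
      2 * D + 1                                                         ∎
      where
      open ≤-Reasoning
      instance
        nonempty : NonZero (length xs)
        nonempty = >-nonZero (∈-length p∈)
      degree≤ : degree xs p ≤ 2 * D
      degree≤ = *-cancelˡ-≤ (length xs) (≤-trans minimal (∑-degree xs bounded))

  greedy-independent : (xs : List A) → Unique xs → OutDegreeBounded xs → Independent xs
  greedy-independent xs = go (length xs) xs ≤-refl
    where
    go : ∀ n xs → length xs ≤ n → Unique xs → OutDegreeBounded xs → Independent xs
    go n       []       _ _ _ = [] , (λ ()) , [] , z≤n
    go zero    (x ∷ xs) () _ _
    go (suc n) xs@(_ ∷ _) len≤ xs! bounded with ∃-≤-average (degree xs) xs (s≤s z≤n)
    ... | p , p∈ , minimal =
      p ∷ cs , p∷cs⊆ , All.tabulate (λ q∈ → kept-compatible p _ (kept-false (cs⊆ q∈))) ∷ cs-compatible ,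
      ≤-trans (≤-reflexive split) (≤-trans (+-mono-≤ (count-removed xs xs! bounded p∈ minimal) len)
                                           (≤-reflexive (sym (*-suc (2 * D + 1) (length cs)))))
      where
      keep : A → Bool
      keep = not ∘ removed p
      kept : List A
      kept = filterᵇ keep xs
      len-kept : suc (length kept) ≤ length xs
      len-kept = ≤-trans (s≤s (≤-reflexive (length-filterᵇ keep xs)))
                         (count-<-length keep p∈ (cong not (removed-self p)))
      kept-false : ∀ {q} → q ∈ kept → removed p q ≡ false
      kept-false q∈ = Boolₚ.not-injective (proj₂ (∈-filterᵇ⁻ keep xs q∈))
      bounded′ : OutDegreeBounded kept
      bounded′ q∈ = ≤-trans (count-filterᵇ-≤ _ keep xs) (bounded (proj₁ (∈-filterᵇ⁻ keep xs q∈)))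
      recursive : Independent kept
      recursive = go n kept (≤-pred (≤-trans len-kept len≤)) (filterᵇ-unique keep xs!) bounded′
      cs : List A
      cs = proj₁ recursive
      cs⊆ : cs ⊆ kept
      cs⊆ = proj₁ (proj₂ recursive)
      cs-compatible : AllPairs Compatible cs
      cs-compatible = proj₁ (proj₂ (proj₂ recursive))
      len : length kept ≤ (2 * D + 1) * length cs
      len = proj₂ (proj₂ (proj₂ recursive))
      p∷cs⊆ : p ∷ cs ⊆ xs
      p∷cs⊆ (here refl) = p∈
      p∷cs⊆ (there q∈)  = proj₁ (∈-filterᵇ⁻ keep xs (cs⊆ q∈))
      split : length xs ≡ count (removed p) xs + length kept
      split = trans (sym (count-+-count-not (removed p) xs)) (cong (count (removed p) xs +_) (sym (length-filterᵇ keep xs)))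

∣p∣≡count : ∀ {n} (p : Subset n) → Subset.∣ p ∣ ≡ count (Vec.lookup p) (allFin n)
∣p∣≡count-tail : ∀ {n} b (p : Subset n) → Subset.∣ p ∣ ≡ count (Vec.lookup (b ∷ p)) (tabulate suc)

∣p∣≡count []                  = refl
∣p∣≡count {suc n} (true ∷ p)  = cong suc (∣p∣≡count-tail true p)
∣p∣≡count {suc n} (false ∷ p) = ∣p∣≡count-tail false p

∣p∣≡count-tail {n} b p = begin
  Subset.∣ p ∣                                     ≡⟨ ∣p∣≡count p ⟩
  count (Vec.lookup p) (allFin n)                  ≡⟨ count-map (Vec.lookup (b ∷ p)) suc (allFin n) ⟨
  count (Vec.lookup (b ∷ p)) (map suc (allFin n))  ≡⟨ cong (count (Vec.lookup (b ∷ p))) (map-tabulate (λ i → i) suc) ⟩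
  count (Vec.lookup (b ∷ p)) (tabulate suc)        ∎
  where open ≡-Reasoning

module _ {n : ℕ} where

  open DecMembership (Finₚ._≟_ {n}) using (_∈?_)

  toSubset : List (Fin n) → Subset n
  toSubset xs = Vec.tabulate (λ i → does (i ∈? xs))

  ∣toSubset∣ : {xs : List (Fin n)} → Unique xs → Subset.∣ toSubset xs ∣ ≡ length xs
  ∣toSubset∣ {xs} xs! = begin
    Subset.∣ toSubset xs ∣                       ≡⟨ ∣p∣≡count (toSubset xs) ⟩
    count (Vec.lookup (toSubset xs)) (allFin n)  ≡⟨ count-cong (lookup∘tabulate _) (allFin n) ⟩
    count (λ i → does (i ∈? xs)) (allFin n)      ≡⟨ count-∈? Finₚ._≟_ xs! (allFin n) (allFin⁺ n) (λ {i} _ → ∈-allFin i) ⟩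
    length xs                                    ∎
    where open ≡-Reasoning

  toSubset-⊆ : {xs : List (Fin n)} {i : Fin n} → i Subset.∈ toSubset xs → i ∈ xs
  toSubset-⊆ {xs} {i} i∈ = does-true (i ∈? xs) (trans (sym (lookup∘tabulate _ i)) ([]=⇒lookup i∈))

module _ {n₁ n₂ : ℕ} (G : BipGraph n₁ n₂) where

  lookup-N : ∀ u w → Vec.lookup (N G u) w ≡ G u w
  lookup-N u = lookup∘tabulate (G u)

  lookup-─ : ∀ {n} (p q : Subset n) i → Vec.lookup (p ─ q) i ≡ Vec.lookup p i ∧ not (Vec.lookup q i)
  lookup-─ (a ∷ p) (true ∷ q)  zero    = sym (Boolₚ.∧-zeroʳ a)
  lookup-─ (a ∷ p) (false ∷ q) zero    = sym (Boolₚ.∧-identityʳ a)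
  lookup-─ (a ∷ p) (b ∷ q)     (suc i) = lookup-─ p q i

  lookup-∪ : ∀ {n} (p q : Subset n) i → Vec.lookup (p ∪ q) i ≡ Vec.lookup p i ∨ Vec.lookup q i
  lookup-∪ p q i = lookup-zipWith _∨_ i p q

  degree≡count : ∀ u → deg G u ≡ count (G u) (allFin n₂)
  degree≡count u = trans (∣p∣≡count (N G u)) (count-cong (lookup-N u) (allFin n₂))

  ∣divb∣≡count : ∀ x y → Subset.∣ divb G x y ∣ ≡ count (λ w → G x w ∧ not (G y w)) (allFin n₂)
  ∣divb∣≡count x y = trans (∣p∣≡count (divb G x y)) (count-cong lookup-divb (allFin n₂))
    where
    lookup-divb : ∀ w → Vec.lookup (divb G x y) w ≡ (G x w ∧ not (G y w))
    lookup-divb w rewrite lookup-─ (N G x) (N G y) w | lookup-N x w | lookup-N y w = refl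

  ∣divb─N∣≡count : ∀ x y v → Subset.∣ divb G x y ─ N G v ∣ ≡ count (λ w → (G x w ∧ not (G y w)) ∧ not (G v w)) (allFin n₂)
  ∣divb─N∣≡count x y v = trans (∣p∣≡count (divb G x y ─ N G v)) (count-cong lookup-divb─N (allFin n₂))
    where
    lookup-divb─N : ∀ w → Vec.lookup (divb G x y ─ N G v) w ≡ ((G x w ∧ not (G y w)) ∧ not (G v w))
    lookup-divb─N w rewrite lookup-─ (divb G x y) (N G v) w | lookup-─ (N G x) (N G y) w
                          | lookup-N x w | lookup-N y w | lookup-N v w = refl

  ∣div∣≡∣divb∣+∣divb∣ : ∀ u v → Subset.∣ div G u v ∣ ≡ Subset.∣ divb G u v ∣ + Subset.∣ divb G v u ∣
  ∣div∣≡∣divb∣+∣divb∣ u v = begin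
    Subset.∣ div G u v ∣
      ≡⟨ ∣p∣≡count (div G u v) ⟩
    count (Vec.lookup (div G u v)) (allFin n₂)
      ≡⟨ count-cong lookup-div (allFin n₂) ⟩
    count (λ w → (G u w ∧ not (G v w)) ∨ (G v w ∧ not (G u w))) (allFin n₂)
      ≡⟨ count-∨-disjoint _ _ (allFin n₂) disjoint ⟩
    count (λ w → G u w ∧ not (G v w)) (allFin n₂) + count (λ w → G v w ∧ not (G u w)) (allFin n₂)
      ≡⟨ cong₂ _+_ (∣divb∣≡count u v) (∣divb∣≡count v u) ⟨
    Subset.∣ divb G u v ∣ + Subset.∣ divb G v u ∣
      ∎
    where
    open ≡-Reasoning
    lookup-div : ∀ w → Vec.lookup (div G u v) w ≡ ((G u w ∧ not (G v w)) ∨ (G v w ∧ not (G u w)))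
    lookup-div w rewrite lookup-∪ (divb G u v) (divb G v u) w | lookup-─ (N G u) (N G v) w
                       | lookup-─ (N G v) (N G u) w | lookup-N u w | lookup-N v w = refl
    disjoint : ∀ w → (G u w ∧ not (G v w)) ≡ true → (G v w ∧ not (G u w)) ≡ true → ⊥
    disjoint w with G u w | G v w
    ... | true  | true  = λ ()
    ... | true  | false = λ _ ()
    ... | false | _     = λ ()

-- Biclique-free graphs

module _ {n₁ n₂ : ℕ} where

  complement : BipGraph n₁ n₂ → BipGraph n₁ n₂
  complement G u w = not (G u w)

  BicliqueFree : BipGraph n₁ n₂ → ℕ → ℕ → Set
  BicliqueFree H t₁ t₂ = ∀ (S : List (Fin n₁)) (T : List (Fin n₂)) → Unique S → Unique T →
    length S ≡ t₁ → length T ≡ t₂ → ¬ (∀ {v w} → v ∈ S → w ∈ T → H v w ≡ true)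

  bipRamsey⇒bicliqueFree : ∀ (G : BipGraph n₁ n₂) {p q t₁ t₂} → BipRamsey G p q →
    n₁ ^ p ≤ 2 ^ (q * t₁) → n₂ ^ p ≤ 2 ^ (q * t₂) → BicliqueFree G t₁ t₂ × BicliqueFree (complement G) t₁ t₂
  bipRamsey⇒bicliqueFree G {t₁ = t₁} {t₂} ramsey t₁-large t₂-large =
    (λ S T S! T! ∣S∣ ∣T∣ complete → proj₁ (no-homogeneous S T S! T! ∣S∣ ∣T∣) (λ u v u∈ v∈ →
      complete (toSubset-⊆ u∈) (toSubset-⊆ v∈))) ,
    (λ S T S! T! ∣S∣ ∣T∣ complete → proj₂ (no-homogeneous S T S! T! ∣S∣ ∣T∣) (λ u v u∈ v∈ →
      Boolₚ.not-injective (complete (toSubset-⊆ u∈) (toSubset-⊆ v∈))))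
    where
    no-homogeneous : ∀ S T → Unique S → Unique T → length S ≡ t₁ → length T ≡ t₂ →
      ¬ Complete G (toSubset S) (toSubset T) × ¬ Empty G (toSubset S) (toSubset T)
    no-homogeneous S T S! T! ∣S∣ ∣T∣ =
      ramsey t₁ t₂ t₁-large t₂-large (toSubset S) (toSubset T) (trans (∣toSubset∣ S!) ∣S∣) (trans (∣toSubset∣ T!) ∣T∣)

missing : ∀ {n₁ n₂} → BipGraph n₁ n₂ → Fin n₁ → List (Fin n₂) → ℕ
missing H v D = count (not ∘ H v) D

module NearlyComplete {n₁ n₂ : ℕ} (H : BipGraph n₁ n₂) {t₁ t₂ : ℕ} (H-free : BicliqueFree H t₁ t₂) (K : ℕ) where

  private
    K≤deg : ∀ v D → suc K * missing H v D ≤ length D → K * length D ≤ suc K * count (H v) D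
    K≤deg v D few-missing = +-cancelˡ-≤ (length D) _ _ (begin
      length D + K * length D                         ≡⟨ cong (suc K *_) (count-+-count-not (H v) D) ⟨
      suc K * (count (H v) D + missing H v D)         ≡⟨ *-distribˡ-+ (suc K) (count (H v) D) (missing H v D) ⟩
      suc K * count (H v) D + suc K * missing H v D   ≤⟨ +-monoʳ-≤ (suc K * count (H v) D) few-missing ⟩
      suc K * count (H v) D + length D                ≡⟨ +-comm (suc K * count (H v) D) (length D) ⟩
      length D + suc K * count (H v) D                ∎)
      where open ≤-Reasoning

  -- double counting the edges between S and D
  ∃-popular : (S : List (Fin n₁)) (D : List (Fin n₂)) → 0 < length D →
              All (λ v → suc K * missing H v D ≤ length D) S →
              ∃ λ w → w ∈ D × K * length S ≤ suc K * count (λ v → H v w) S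
  ∃-popular S D D≢[] few-missing with ∃-≥-average (λ w → count (λ v → H v w) S) D D≢[]
  ... | w , w∈ , avg≤ = w , w∈ , *-cancelˡ-≤ (length D) {{>-nonZero D≢[]}} (begin
    length D * (K * length S)                        ≡⟨ rearrange₁ (length D) K (length S) ⟩
    length S * (K * length D)                        ≡⟨ ∑-const (K * length D) S ⟨
    ∑[ v ∈ S ] (K * length D)                        ≤⟨ ∑-mono S (λ v v∈ → K≤deg v D (All.lookup few-missing v∈)) ⟩
    ∑[ v ∈ S ] (suc K * count (H v) D)               ≡⟨ ∑-*ˡ (suc K) (λ v → count (H v) D) S ⟩
    suc K * ∑[ v ∈ S ] count (H v) D                 ≡⟨ cong (suc K *_) (∑-swap (λ v w → indicator (H v w)) S D) ⟩
    suc K * ∑[ w ∈ D ] count (λ v → H v w) S         ≤⟨ *-monoʳ-≤ (suc K) avg≤ ⟩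
    suc K * (length D * count (λ v → H v w) S)       ≡⟨ rearrange₂ (suc K) (length D) _ ⟩
    length D * (suc K * count (λ v → H v w) S)       ∎)
    where
    open ≤-Reasoning
    rearrange₁ : ∀ a b c → a * (b * c) ≡ c * (b * a)
    rearrange₁ = solve-∀
    rearrange₂ : ∀ a b c → a * (b * c) ≡ b * (a * c)
    rearrange₂ = solve-∀

  -- S × T stays complete while each step moves a popular vertex of D into T and shrinks S by a factor
  -- of at most K / (K + 1); after r steps S × T is a forbidden biclique.
  grow-biclique : ∀ r (S : List (Fin n₁)) (D T : List (Fin n₂)) → Unique S → Unique D → Unique T →
    Disjoint T D → (∀ {v w} → v ∈ S → w ∈ T → H v w ≡ true) → r ≤ length D →
    All (λ v → suc K * missing H v D + r ≤ length D) S → length T + r ≡ t₂ →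
    ¬ (t₁ * suc K ^ r ≤ length S * K ^ r)
  grow-biclique zero S D T S! D! T! _ complete _ _ ∣T∣ large =
    H-free (take t₁ S) T (take⁺ t₁ S!) T! (trans (length-take t₁ S) (m≤n⇒m⊓n≡m t₁≤∣S∣)) (trans (sym (+-identityʳ _)) ∣T∣)
      (λ v∈ w∈ → complete (Any-resp-⊆ (take-⊆ t₁ S) v∈) w∈)
    where
    t₁≤∣S∣ : t₁ ≤ length S
    t₁≤∣S∣ = subst₂ _≤_ (*-identityʳ t₁) (*-identityʳ (length S)) large
  grow-biclique (suc r) S D T S! D! T! T∩D≡∅ complete r<∣D∣ few-missing ∣T∣ large
    with ∃-popular S D (≤-trans (s≤s z≤n) r<∣D∣) (All.map (≤-trans (m≤m+n _ (suc r))) few-missing)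
  ... | w , w∈D , popular =
    grow-biclique r S′ D′ (w ∷ T) (filterᵇ-unique _ S!) (remove-unique Finₚ._≟_ w D!)
      (Allₚ.¬Any⇒All¬ T (λ w∈T → T∩D≡∅ (w∈T , w∈D)) ∷ T!) disjoint′ complete′ r≤∣D′∣ few-missing′
      (trans (sym (+-suc (length T) r)) ∣T∣) large′
    where
    open ≤-Reasoning
    S′ : List (Fin n₁)
    S′ = filterᵇ (λ v → H v w) S
    D′ : List (Fin n₂)
    D′ = remove Finₚ._≟_ w D
    ∣D′∣ : suc (length D′) ≡ length D
    ∣D′∣ = length-remove Finₚ._≟_ w D! w∈D
    disjoint′ : Disjoint (w ∷ T) D′
    disjoint′ (here refl , w∈D′) = remove-∉ Finₚ._≟_ w D w∈D′
    disjoint′ (there x∈T , x∈D′) = T∩D≡∅ (x∈T , remove-⊆ Finₚ._≟_ w D x∈D′)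
    complete′ : ∀ {v x} → v ∈ S′ → x ∈ w ∷ T → H v x ≡ true
    complete′ v∈ (here refl) = proj₂ (∈-filterᵇ⁻ (λ v → H v w) S v∈)
    complete′ v∈ (there x∈) = complete (proj₁ (∈-filterᵇ⁻ (λ v → H v w) S v∈)) x∈
    r≤∣D′∣ : r ≤ length D′
    r≤∣D′∣ = ≤-pred (subst (suc r ≤_) (sym ∣D′∣) r<∣D∣)
    few-missing′ : All (λ v → suc K * missing H v D′ + r ≤ length D′) S′
    few-missing′ = All.tabulate λ {v} v∈ → ≤-pred (subst (suc (suc K * missing H v D′ + r) ≤_) (sym ∣D′∣) (begin
      suc (suc K * missing H v D′ + r) ≤⟨ s≤s (+-monoˡ-≤ r (*-monoʳ-≤ (suc K) (count-filterᵇ-≤ _ _ D))) ⟩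
      suc (suc K * missing H v D + r)  ≡⟨ +-suc _ r ⟨
      suc K * missing H v D + suc r    ≤⟨ All.lookup few-missing (proj₁ (∈-filterᵇ⁻ (λ v → H v w) S v∈)) ⟩
      length D                         ∎))
    large′ : t₁ * suc K ^ r ≤ length S′ * K ^ r
    large′ = *-cancelˡ-≤ (suc K) (begin
      suc K * (t₁ * suc K ^ r)                ≡⟨ x*[y*z]≡y*[x*z] (suc K) t₁ (suc K ^ r) ⟩
      t₁ * (suc K * suc K ^ r)                ≤⟨ large ⟩
      length S * (K * K ^ r)                  ≡⟨ x*[y*z]≡z*[y*x] (length S) K (K ^ r) ⟩
      K ^ r * (K * length S)                  ≤⟨ *-monoʳ-≤ (K ^ r) popular ⟩
      K ^ r * (suc K * count (λ v → H v w) S) ≡⟨ cong (λ n → K ^ r * (suc K * n)) (length-filterᵇ _ S) ⟨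
      K ^ r * (suc K * length S′)             ≡⟨ x*[y*z]≡y*[z*x] (K ^ r) (suc K) (length S′) ⟩
      suc K * (length S′ * K ^ r)             ∎)
      where
      x*[y*z]≡y*[x*z] : ∀ x y z → x * (y * z) ≡ y * (x * z)
      x*[y*z]≡y*[x*z] = solve-∀
      x*[y*z]≡z*[y*x] : ∀ x y z → x * (y * z) ≡ z * (y * x)
      x*[y*z]≡z*[y*x] = solve-∀
      x*[y*z]≡y*[z*x] : ∀ x y z → x * (y * z) ≡ y * (z * x)
      x*[y*z]≡y*[z*x] = solve-∀

  few-nearly-complete : (S : List (Fin n₁)) (D : List (Fin n₂)) → Unique S → Unique D → t₂ ≤ length D →
    All (λ v → suc K * missing H v D + t₂ ≤ length D) S → length S * K ^ t₂ < t₁ * suc K ^ t₂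
  few-nearly-complete S D S! D! t₂≤∣D∣ few-missing =
    ≰⇒> (grow-biclique t₂ S D [] S! D! [] (λ ()) (λ _ ()) t₂≤∣D∣ few-missing refl)

-- Close and blocking vertices, and the pair-matching

half-sum : ∀ a b {d} → 2 * a < d → 2 * b ≤ d → a + b ≤ d
half-sum a b {d} 2a<d 2b≤d = *-cancelˡ-≤ 2 (<⇒≤ (begin-strict
  2 * (a + b)     ≡⟨ *-distribˡ-+ 2 a b ⟩
  2 * a + 2 * b   <⟨ +-mono-<-≤ 2a<d 2b≤d ⟩
  d + d           ≡⟨ cong (d +_) (+-identityʳ d) ⟨
  2 * d           ∎))
  where open ≤-Reasoning

∸-<-of-/-≡ : ∀ m n d .{{_ : NonZero d}} → m / d ≡ n / d → m ∸ n < d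
∸-<-of-/-≡ m n d same = begin-strict
  m ∸ n            ≤⟨ ∸-monoʳ-≤ m (subst (λ q → q * d ≤ n) (sym same) (m/n*n≤m n d)) ⟩
  m ∸ m / d * d    ≡⟨ m%n≡m∸m/n*n m d ⟨
  m % d            <⟨ m%n<n m d ⟩
  d                ∎
  where open ≤-Reasoning

module BicliqueFreeGraph {n₁ n₂ : ℕ} (G : BipGraph n₁ n₂) (K t₁ t₂ B : ℕ)
  (G-free : BicliqueFree G t₁ t₂) (Ḡ-free : BicliqueFree (complement G) t₁ t₂)
  (few : ∀ m → m * K ^ t₂ < t₁ * suc K ^ t₂ → m < B)
  (t₂-small : 16 * (suc K * t₂) ≤ n₂) where

  L : ℕ
  L = suc K

  few-nearly-containing : (H : BipGraph n₁ n₂) → BicliqueFree H t₁ t₂ →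
    (D : List (Fin n₂)) (vs : List (Fin n₁)) → Unique D → Unique vs → 2 * t₂ ≤ length D →
    All (λ v → 2 * (L * missing H v D) < length D) vs → length vs < B
  few-nearly-containing H H-free D vs D! vs! 2t₂≤∣D∣ nearly =
    few (length vs) (NearlyComplete.few-nearly-complete H H-free K vs D vs! D! t₂≤∣D∣
      (All.map (λ {v} 2Lm<∣D∣ → half-sum (L * missing H v D) t₂ 2Lm<∣D∣ 2t₂≤∣D∣) nearly))
    where
    t₂≤∣D∣ : t₂ ≤ length D
    t₂≤∣D∣ = ≤-trans (m≤m+n t₂ (t₂ + 0)) 2t₂≤∣D∣

  private
    4t₂≤n₂ : 4 * t₂ ≤ n₂
    4t₂≤n₂ = ≤-trans (*-monoʳ-≤ 4 (m≤n*m t₂ L)) (≤-trans (*-monoˡ-≤ (L * t₂) (m≤m+n 4 12)) t₂-small)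

  few-close-in : (H : BipGraph n₁ n₂) → BicliqueFree H t₁ t₂ → ∀ u (D : List (Fin n₂)) → Unique D →
    n₂ ≤ 2 * length D → (∀ v → missing H v D ≤ Subset.∣ div G u v ∣) →
    ∀ vs → Unique vs → All (λ v → 4 * (L * Subset.∣ div G u v ∣) < n₂) vs → length vs < B
  few-close-in H H-free u D D! n₂≤2∣D∣ missing≤div vs vs! close =
    few-nearly-containing H H-free D vs D! vs! (*-cancelˡ-≤ 2 (≤-trans (≤-reflexive (two-twos t₂)) (≤-trans 4t₂≤n₂ n₂≤2∣D∣)))
      (All.tabulate λ {v} v∈ → *-cancelˡ-< 2 _ _ (begin-strict
        2 * (2 * (L * missing H v D))  ≡⟨ two-twos (L * missing H v D) ⟩
        4 * (L * missing H v D)        ≤⟨ *-monoʳ-≤ 4 (*-monoʳ-≤ L (missing≤div v)) ⟩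
        4 * (L * Subset.∣ div G u v ∣) <⟨ All.lookup close v∈ ⟩
        n₂                             ≤⟨ n₂≤2∣D∣ ⟩
        2 * length D                   ∎))
    where
    open ≤-Reasoning
    two-twos : ∀ a → 2 * (2 * a) ≡ 4 * a
    two-twos = solve-∀

  -- D is N(u) in G or V₂ ∖ N(u) in the complement, whichever has at least n₂ / 2 vertices
  few-close : ∀ u vs → Unique vs → All (λ v → 4 * (L * Subset.∣ div G u v ∣) < n₂) vs → length vs < B
  few-close u with n₂ ≤? 2 * deg G u
  ... | yes n₂≤2d = few-close-in G G-free u D (filterᵇ-unique _ (allFin⁺ n₂)) n₂≤2∣D∣ missing≤div
    where
    D : List (Fin n₂)
    D = filterᵇ (G u) (allFin n₂)
    n₂≤2∣D∣ : n₂ ≤ 2 * length D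
    n₂≤2∣D∣ = subst (λ m → n₂ ≤ 2 * m) (trans (degree≡count G u) (sym (length-filterᵇ (G u) (allFin n₂)))) n₂≤2d
    missing≤div : ∀ v → missing G v D ≤ Subset.∣ div G u v ∣
    missing≤div v = begin
      missing G v D                                           ≡⟨ count-filterᵇ _ (G u) (allFin n₂) ⟩
      count (λ w → G u w ∧ not (G v w)) (allFin n₂)           ≡⟨ ∣divb∣≡count G u v ⟨
      Subset.∣ divb G u v ∣                                   ≤⟨ m≤m+n _ _ ⟩
      Subset.∣ divb G u v ∣ + Subset.∣ divb G v u ∣           ≡⟨ ∣div∣≡∣divb∣+∣divb∣ G u v ⟨
      Subset.∣ div G u v ∣                                    ∎
      where open ≤-Reasoning
  ... | no n₂≰2d = few-close-in (complement G) Ḡ-free u D (filterᵇ-unique _ (allFin⁺ n₂)) n₂≤2∣D∣ missing≤div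
    where
    D : List (Fin n₂)
    D = filterᵇ (not ∘ G u) (allFin n₂)
    d+∣D∣≡n₂ : deg G u + length D ≡ n₂
    d+∣D∣≡n₂ = trans (cong₂ _+_ (degree≡count G u) (length-filterᵇ _ (allFin n₂)))
                    (trans (count-+-count-not (G u) (allFin n₂)) (length-tabulate (λ i → i)))
    d<∣D∣ : deg G u < length D
    d<∣D∣ = +-cancelˡ-< (deg G u) (deg G u) (length D)
              (subst₂ _<_ (cong (deg G u +_) (+-identityʳ (deg G u))) (sym d+∣D∣≡n₂) (≰⇒> n₂≰2d))
    n₂≤2∣D∣ : n₂ ≤ 2 * length D
    n₂≤2∣D∣ = begin
      n₂                       ≡⟨ d+∣D∣≡n₂ ⟨
      deg G u + length D       ≤⟨ +-monoˡ-≤ (length D) (<⇒≤ d<∣D∣) ⟩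
      length D + length D      ≡⟨ cong (length D +_) (+-identityʳ (length D)) ⟨
      2 * length D             ∎
      where open ≤-Reasoning
    missing≤div : ∀ v → missing (complement G) v D ≤ Subset.∣ div G u v ∣
    missing≤div v = begin
      missing (complement G) v D                                ≡⟨ count-filterᵇ _ (not ∘ G u) (allFin n₂) ⟩
      count (λ w → not (G u w) ∧ not (not (G v w))) (allFin n₂) ≡⟨ count-cong swap (allFin n₂) ⟩
      count (λ w → G v w ∧ not (G u w)) (allFin n₂)             ≡⟨ ∣divb∣≡count G v u ⟨
      Subset.∣ divb G v u ∣                                     ≤⟨ m≤n+m _ _ ⟩
      Subset.∣ divb G u v ∣ + Subset.∣ divb G v u ∣             ≡⟨ ∣div∣≡∣divb∣+∣divb∣ G u v ⟨
      Subset.∣ div G u v ∣                                      ∎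
      where
      open ≤-Reasoning
      swap : ∀ w → (not (G u w) ∧ not (not (G v w))) ≡ (G v w ∧ not (G u w))
      swap w with G u w | G v w
      ... | true  | true  = refl
      ... | true  | false = refl
      ... | false | true  = refl
      ... | false | false = refl

  ε⁻¹ : ℕ
  ε⁻¹ = 16 * (L * L)

  few-blocking : ∀ x y → n₂ ≤ 8 * (L * Subset.∣ divb G x y ∣) →
    ∀ vs → Unique vs → All (λ v → ε⁻¹ * Subset.∣ divb G x y ─ N G v ∣ < n₂) vs → length vs < B
  few-blocking x y n₂≤8L∣D∣ vs vs! blocking =
    few-nearly-containing G G-free D vs (filterᵇ-unique _ (allFin⁺ n₂)) vs!
      (*-cancelˡ-≤ (8 * L) (begin
        8 * L * (2 * t₂)       ≡⟨ 16Lt₂ L t₂ ⟩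
        16 * (L * t₂)          ≤⟨ t₂-small ⟩
        n₂                     ≤⟨ n₂≤8L∣D∣′ ⟩
        8 * L * length D       ∎))
      (All.tabulate λ {v} v∈ → *-cancelˡ-< (8 * L) _ _ (begin-strict
        8 * L * (2 * (L * missing G v D))       ≡⟨ 16L²m L (missing G v D) ⟩
        ε⁻¹ * missing G v D                     ≡⟨ cong (ε⁻¹ *_) (missing≡∣divb─N∣ v) ⟩
        ε⁻¹ * Subset.∣ divb G x y ─ N G v ∣     <⟨ All.lookup blocking v∈ ⟩
        n₂                                      ≤⟨ n₂≤8L∣D∣′ ⟩
        8 * L * length D                        ∎))
    where
    open ≤-Reasoning
    D : List (Fin n₂)
    D = filterᵇ (λ w → G x w ∧ not (G y w)) (allFin n₂)
    n₂≤8L∣D∣′ : n₂ ≤ 8 * L * length D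
    n₂≤8L∣D∣′ = subst (n₂ ≤_) (trans (sym (*-assoc 8 L _)) (cong (8 * L *_) ∣divb∣≡∣D∣)) n₂≤8L∣D∣
      where
      ∣divb∣≡∣D∣ : Subset.∣ divb G x y ∣ ≡ length D
      ∣divb∣≡∣D∣ = trans (∣divb∣≡count G x y) (sym (length-filterᵇ _ (allFin n₂)))
    missing≡∣divb─N∣ : ∀ v → missing G v D ≡ Subset.∣ divb G x y ─ N G v ∣
    missing≡∣divb─N∣ v = trans (count-filterᵇ _ _ (allFin n₂)) (sym (∣divb─N∣≡count G x y v))
    16Lt₂ : ∀ L t → 8 * L * (2 * t) ≡ 16 * (L * t)
    16Lt₂ = solve-∀
    16L²m : ∀ L m → 8 * L * (2 * (L * m)) ≡ 16 * (L * L) * m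
    16L²m = solve-∀

  -- the last condition makes few-blocking applicable to the pair
  GoodPair : Fin n₁ × Fin n₁ → Set
  GoodPair (x , y) = PairConvention G x y × (deg G x ∸ deg G y) * (deg G x ∸ deg G y) ≤ n₂
                   × n₂ ≤ 8 * (L * Subset.∣ divb G x y ∣)

  far : Fin n₁ → Fin n₁ → Bool
  far u v = does (n₂ ≤? 4 * (L * Subset.∣ div G u v ∣))

  module DegreeBuckets (s : ℕ) .{{_ : NonZero s}} (s²≤n₂ : s * s ≤ n₂) (X : ℕ) (n₂<Xs : n₂ < X * s) where

    in-bucket : ℕ → Fin n₁ → Bool
    in-bucket c v = does (c ≟ deg G v / s)

    bucket : ℕ → List (Fin n₁)
    bucket c = filterᵇ (in-bucket c) (allFin n₁)

    ∈-bucket : ∀ c {v} → v ∈ bucket c → c ≡ deg G v / s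
    ∈-bucket c {v} v∈ = does-true (c ≟ deg G v / s) (proj₂ (∈-filterᵇ⁻ (in-bucket c) (allFin n₁) v∈))

    close-degrees : ∀ x y → deg G x / s ≡ deg G y / s → (deg G x ∸ deg G y) * (deg G x ∸ deg G y) ≤ n₂
    close-degrees x y same = ≤-trans (*-mono-≤ d≤s d≤s) s²≤n₂
      where
      d≤s : deg G x ∸ deg G y ≤ s
      d≤s = <⇒≤ (∸-<-of-/-≡ (deg G x) (deg G y) s same)

    far-divb : ∀ x y → Subset.∣ divb G y x ∣ ≤ Subset.∣ divb G x y ∣ → far x y ≡ true → n₂ ≤ 8 * (L * Subset.∣ divb G x y ∣)
    far-divb x y yx≤xy far-xy = begin
      n₂                                                        ≤⟨ does-true (n₂ ≤? 4 * (L * Subset.∣ div G x y ∣)) far-xy ⟩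
      4 * (L * Subset.∣ div G x y ∣)                            ≡⟨ cong (λ m → 4 * (L * m)) (∣div∣≡∣divb∣+∣divb∣ G x y) ⟩
      4 * (L * (Subset.∣ divb G x y ∣ + Subset.∣ divb G y x ∣)) ≤⟨ *-monoʳ-≤ 4 (*-monoʳ-≤ L (+-monoʳ-≤ (Subset.∣ divb G x y ∣) yx≤xy)) ⟩
      4 * (L * (Subset.∣ divb G x y ∣ + Subset.∣ divb G x y ∣)) ≡⟨ doubling L (Subset.∣ divb G x y ∣) ⟩
      8 * (L * Subset.∣ divb G x y ∣)                           ∎
      where
      open ≤-Reasoning
      doubling : ∀ L b → 4 * (L * (b + b)) ≡ 8 * (L * b)
      doubling = solve-∀

    orient : ∀ c {u v} → u ∈ bucket c → v ∈ bucket c → far u v ≡ true → GoodPair (u , v) ⊎ GoodPair (v , u)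
    orient c {u} {v} u∈ v∈ far-uv with ≤-total (Subset.∣ divb G v u ∣) (Subset.∣ divb G u v ∣)
    ... | inj₁ vu≤uv = inj₁ (vu≤uv , close-degrees u v (trans (sym (∈-bucket c u∈)) (∈-bucket c v∈)) , far-divb u v vu≤uv far-uv)
    ... | inj₂ uv≤vu = inj₂ (uv≤vu , close-degrees v u (trans (sym (∈-bucket c v∈)) (∈-bucket c u∈)) ,
                             far-divb v u uv≤vu (subst (λ m → does (n₂ ≤? 4 * (L * m)) ≡ true) (div-comm u v) far-uv))
      where
      div-comm : ∀ u v → Subset.∣ div G u v ∣ ≡ Subset.∣ div G v u ∣
      div-comm u v = trans (∣div∣≡∣divb∣+∣divb∣ G u v)
                       (trans (+-comm (Subset.∣ divb G u v ∣) _) (sym (∣div∣≡∣divb∣+∣divb∣ G v u)))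

    open GreedyMatching Finₚ._≟_ far B
      (λ u vs vs! close → few-close u vs vs! (All.map (λ {v} not-far → ≰⇒> (does-false (n₂ ≤? _) not-far)) close))
      GoodPair

    matching-in-buckets : (cs : List ℕ) → Unique cs →
      ∃ λ ps → Unique (endpoints ps) × All GoodPair ps × (∀ {z} → z ∈ endpoints ps → deg G z / s ∈ cs)
             × ∑[ c ∈ cs ] length (bucket c) ≤ 2 * length ps + length cs * B
    matching-in-buckets []       _            = [] , [] , [] , (λ ()) , z≤n
    matching-in-buckets (c ∷ cs) (c∉cs ∷ cs!)
      with ps , ps! , ps⊆ , good , len ← greedy-matching (bucket c) (filterᵇ-unique _ (allFin⁺ n₁)) (orient c)
         | qs , qs! , good′ , qs-buckets , len′ ← matching-in-buckets cs cs! =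
      ps ++ qs , subst Unique (sym (endpoints-++ ps qs)) (Uniqueₚ.++⁺ ps! qs! disjoint) , Allₚ.++⁺ good good′ ,
      buckets , total
      where
      disjoint : Disjoint (endpoints ps) (endpoints qs)
      disjoint (z∈ps , z∈qs) = Allₚ.All¬⇒¬Any c∉cs (subst (_∈ cs) (sym (∈-bucket c (ps⊆ z∈ps))) (qs-buckets z∈qs))
      buckets : ∀ {z} → z ∈ endpoints (ps ++ qs) → deg G z / s ∈ c ∷ cs
      buckets {z} z∈ with ∈-++⁻ (endpoints ps) (subst (z ∈_) (endpoints-++ ps qs) z∈)
      ... | inj₁ z∈ps = here (sym (∈-bucket c (ps⊆ z∈ps)))
      ... | inj₂ z∈qs = there (qs-buckets z∈qs)
      total : ∑[ c ∈ c ∷ cs ] length (bucket c) ≤ 2 * length (ps ++ qs) + length (c ∷ cs) * B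
      total = begin
        length (bucket c) + ∑[ c ∈ cs ] length (bucket c)              ≤⟨ +-mono-≤ len len′ ⟩
        (2 * length ps + B) + (2 * length qs + length cs * B)          ≡⟨ regroup (length ps) (length qs) (length cs) B ⟩
        2 * (length ps + length qs) + suc (length cs) * B              ≡⟨ cong (λ m → 2 * m + suc (length cs) * B) (length-++ ps) ⟨
        2 * length (ps ++ qs) + length (c ∷ cs) * B                    ∎
        where
        open ≤-Reasoning
        regroup : ∀ a b c B → (2 * a + B) + (2 * b + c * B) ≡ 2 * (a + b) + suc c * B
        regroup = solve-∀

    -- every vertex lies in exactly one of the buckets 0, …, X − 1
    ∑-bucket-sizes : ∑[ c ∈ upTo X ] length (bucket c) ≡ n₁
    ∑-bucket-sizes = begin
      ∑[ c ∈ upTo X ] length (bucket c)                       ≡⟨ ∑-cong (λ c → length-filterᵇ (in-bucket c) (allFin n₁)) (upTo X) ⟩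
      ∑[ c ∈ upTo X ] count (in-bucket c) (allFin n₁)         ≡⟨ ∑-swap (λ c v → indicator (in-bucket c v)) (upTo X) (allFin n₁) ⟩
      ∑[ v ∈ allFin n₁ ] count (λ c → in-bucket c v) (upTo X) ≡⟨ ∑-cong one-bucket (allFin n₁) ⟩
      ∑[ v ∈ allFin n₁ ] 1                                    ≡⟨ ∑-const 1 (allFin n₁) ⟩
      length (allFin n₁) * 1                                  ≡⟨ *-identityʳ _ ⟩
      length (allFin n₁)                                      ≡⟨ length-tabulate (λ i → i) ⟩
      n₁                                                      ∎
      where
      open ≡-Reasoning
      one-bucket : ∀ v → count (λ c → in-bucket c v) (upTo X) ≡ 1
      one-bucket v = count-≟ _≟_ (deg G v / s) (upTo⁺ X) (∈-upTo⁺ (m<n*o⇒m/o<n (≤-<-trans (∣p∣≤n (N G v)) n₂<Xs)))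

    many-good-pairs : ∃ λ ps → Unique (endpoints ps) × All GoodPair ps × n₁ ≤ 2 * length ps + X * B
    many-good-pairs with ps , ps! , good , _ , len ← matching-in-buckets (upTo X) (upTo⁺ X) =
      ps , ps! , good , subst₂ _≤_ ∑-bucket-sizes (cong (λ m → 2 * length ps + m * B) (length-upTo X)) len

  blocks : Fin n₁ × Fin n₁ → Fin n₁ → Bool
  blocks (x , y) v = does (ε⁻¹ * Subset.∣ divb G x y ─ N G v ∣ <? n₂)

  conflict : Fin n₁ × Fin n₁ → Fin n₁ × Fin n₁ → Bool
  conflict p q = blocks p (proj₁ q) ∨ blocks p (proj₂ q)

  -- the first vertices of the pairs are distinct, and so are the second ones; fewer than B of each block p
  few-conflicts : (ps : List (Fin n₁ × Fin n₁)) → Unique (endpoints ps) → ∀ {p} → GoodPair p → count (conflict p) ps ≤ 2 * B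
  few-conflicts ps ps! {x , y} (_ , _ , far-xy) = begin
    count (conflict (x , y)) ps                                                   ≤⟨ count-∨ _ _ ps ⟩
    count (blocks (x , y) ∘ proj₁) ps + count (blocks (x , y) ∘ proj₂) ps         ≡⟨ cong₂ _+_ (count-map _ proj₁ ps) (count-map _ proj₂ ps) ⟨
    count (blocks (x , y)) (map proj₁ ps) + count (blocks (x , y)) (map proj₂ ps) ≤⟨ +-mono-≤ (few-in (unique-map-proj₁ ps ps!)) (few-in (unique-map-proj₂ ps ps!)) ⟩
    B + B                                                                         ≡⟨ cong (B +_) (+-identityʳ B) ⟨
    2 * B                                                                         ∎
    where
    open ≤-Reasoning
    few-in : {vs : List (Fin n₁)} → Unique vs → count (blocks (x , y)) vs ≤ B
    few-in {vs} vs! = <⇒≤ (subst (_< B) (length-filterᵇ (blocks (x , y)) vs)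
      (few-blocking x y far-xy (filterᵇ (blocks (x , y)) vs) (filterᵇ-unique _ vs!)
        (All.tabulate λ {v} v∈ → does-true (_ <? n₂) (proj₂ (∈-filterᵇ⁻ (blocks (x , y)) vs v∈)))))

  open GreedyIndependentSet (≡-dec Finₚ._≟_ Finₚ._≟_) conflict (2 * B)

  pair-matching : {ps cs : List (Fin n₁ × Fin n₁)} → Unique (endpoints ps) → All GoodPair ps →
    cs ⊆ ps → AllPairs Compatible cs → ∀ k → k ≤ length cs → PairMatching G 1 ε⁻¹ k
  pair-matching {ps} {cs} ps! good cs⊆ compatible k k≤ =
    x , y , x-injective , y-injective , x≢y , (proj₁ ∘ good-pair) , (proj₁ ∘ proj₂ ∘ good-pair) , unblocked
    where
    pair : Fin k → Fin n₁ × Fin n₁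
    pair i = lookup cs (inject≤ i k≤)
    x y : Fin k → Fin n₁
    x = proj₁ ∘ pair
    y = proj₂ ∘ pair
    pair∈ : ∀ i → pair i ∈ ps
    pair∈ i = cs⊆ (∈-lookup _)
    good-pair : ∀ i → GoodPair (pair i)
    good-pair i = All.lookup good (pair∈ i)
    compatible-pairs : ∀ {i j} → i ≢ j → Compatible (pair i) (pair j)
    compatible-pairs i≢j = AllPairs-lookup (λ (pq , qp , p≢q) → qp , pq , p≢q ∘ sym) compatible
                                           (i≢j ∘ Finₚ.inject≤-injective k≤ k≤ _ _)
    disjoint : ∀ {i j} → i ≢ j → Disjoint (endpoints (pair i ∷ [])) (endpoints (pair j ∷ []))
    disjoint i≢j = endpoints-disjoint ps! (pair∈ _) (pair∈ _) (proj₂ (proj₂ (compatible-pairs i≢j)))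
    x-injective : ∀ {i j} → x i ≡ x j → i ≡ j
    x-injective {i} {j} xi≡xj with i Finₚ.≟ j
    ... | yes i≡j = i≡j
    ... | no  i≢j = ⊥-elim (disjoint i≢j (here refl , here xi≡xj))
    y-injective : ∀ {i j} → y i ≡ y j → i ≡ j
    y-injective {i} {j} yi≡yj with i Finₚ.≟ j
    ... | yes i≡j = i≡j
    ... | no  i≢j = ⊥-elim (disjoint i≢j (there (here refl) , there (here yi≡yj)))
    x≢y : ∀ i j → x i ≢ y j
    x≢y i j xi≡yj with i Finₚ.≟ j
    ... | yes refl = endpoints-distinct ps! (pair∈ i) xi≡yj
    ... | no  i≢j  = disjoint i≢j (here refl , there (here xi≡yj))
    ε-large : ∀ A → does (ε⁻¹ * Subset.∣ A ∣ <? n₂) ≡ false → AtLeastεV₂ G 1 ε⁻¹ A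
    ε-large A not-small =
      subst (_≤ ε⁻¹ * Subset.∣ A ∣) (sym (+-identityʳ n₂)) (≮⇒≥ (does-false (ε⁻¹ * Subset.∣ A ∣ <? n₂) not-small))
    unblocked : ∀ i j → i ≢ j → AtLeastεV₂ G 1 ε⁻¹ (divb G (x i) (y i) ─ N G (x j))
                              × AtLeastεV₂ G 1 ε⁻¹ (divb G (x i) (y i) ─ N G (y j))
    unblocked i j i≢j with proj₁ (compatible-pairs i≢j)
    ... | no-conflict = ε-large (divb G (x i) (y i) ─ N G (x j)) (Boolₚ.∨-conicalˡ _ _ no-conflict) ,
                        ε-large (divb G (x i) (y i) ─ N G (y j)) (Boolₚ.∨-conicalʳ _ _ no-conflict)

  pair-matchings : ∀ s .{{_ : NonZero s}} → s * s ≤ n₂ → ∀ X → n₂ < X * s →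
    ∃ λ m → n₁ ≤ 2 * ((2 * (2 * B) + 1) * m) + X * B × (∀ k → k ≤ m → PairMatching G 1 ε⁻¹ k)
  pair-matchings s s²≤n₂ X n₂<Xs = select (DegreeBuckets.many-good-pairs s s²≤n₂ X n₂<Xs)
    where
    select : (∃ λ ps → Unique (endpoints ps) × All GoodPair ps × n₁ ≤ 2 * length ps + X * B) →
             ∃ λ m → n₁ ≤ 2 * ((2 * (2 * B) + 1) * m) + X * B × (∀ k → k ≤ m → PairMatching G 1 ε⁻¹ k)
    select (ps , ps! , good , n₁≤) = finish (greedy-independent ps (endpoints-unique⇒unique ps ps!)
                                                (λ p∈ → few-conflicts ps ps! (All.lookup good p∈)))
      where
      finish : Independent ps →
               ∃ λ m → n₁ ≤ 2 * ((2 * (2 * B) + 1) * m) + X * B × (∀ k → k ≤ m → PairMatching G 1 ε⁻¹ k)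
      finish (cs , cs⊆ , compatible , ps≤) =
        length cs , ≤-trans n₁≤ (+-monoˡ-≤ (X * B) (*-monoʳ-≤ 2 ps≤)) , pair-matching ps! good cs⊆ compatible

-- Numerical estimates

n<b^n : ∀ b .{{_ : NonZero b}} → 1 < b → ∀ n → n < b ^ n
n<b^n b 1<b zero    = s≤s z≤n
n<b^n b 1<b (suc n) = begin-strict
  suc n             <⟨ s≤s (n<b^n b 1<b n) ⟩
  suc (b ^ n)       ≤⟨ +-monoˡ-≤ (b ^ n) (m^n>0 b n) ⟩
  b ^ n + b ^ n     ≡⟨ cong (b ^ n +_) (+-identityʳ (b ^ n)) ⟨
  2 * b ^ n         ≤⟨ *-monoˡ-≤ (b ^ n) 1<b ⟩
  b * b ^ n         ∎
  where open ≤-Reasoning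

power-bracket : ∀ b .{{_ : NonZero b}} n → 1 < b → 1 < n → ∃ λ m → b ^ m < n × n ≤ b ^ suc m
power-bracket b n 1<b 1<n = below n (<⇒≤ (n<b^n b 1<b n))
  where
  below : ∀ m → n ≤ b ^ m → ∃ λ m → b ^ m < n × n ≤ b ^ suc m
  below zero    n≤1 = ⊥-elim (<⇒≱ 1<n n≤1)
  below (suc m) n≤b^[1+m] with n ≤? b ^ m
  ... | yes n≤b^m = below m n≤b^m
  ... | no  n≰b^m = m , ≰⇒> n≰b^m , n≤b^[1+m]

∃-isqrt : ∀ n → ∃ λ s → s * s ≤ n × n < suc s * suc s
∃-isqrt zero = 0 , z≤n , s≤s z≤n
∃-isqrt (suc n) with ∃-isqrt n
... | s , s²≤n , n<[1+s]² with suc n <? suc s * suc s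
...   | yes 1+n<[1+s]² = s , m≤n⇒m≤1+n s²≤n , 1+n<[1+s]²
...   | no  1+n≮[1+s]² = suc s , ≮⇒≥ 1+n≮[1+s]² , ≤-<-trans n<[1+s]² (*-mono-< (n<1+n (suc s)) (n<1+n (suc s)))

^-distribʳ-* : ∀ a b m → (a * b) ^ m ≡ a ^ m * b ^ m
^-distribʳ-* a b zero    = refl
^-distribʳ-* a b (suc m) = trans (cong (a * b *_) (^-distribʳ-* a b m)) (interchange a b (a ^ m) (b ^ m))
  where
  interchange : ∀ a b c d → a * b * (c * d) ≡ a * c * (b * d)
  interchange = solve-∀

c*[1+m]≤4^m : ∀ c m → c ≤ m → c * suc m ≤ 4 ^ m
c*[1+m]≤4^m c m c≤m = begin
  c * suc m        ≤⟨ *-mono-≤ (≤-trans c≤m (<⇒≤ (n<b^n 2 (s≤s (s≤s z≤n)) m))) (n<b^n 2 (s≤s (s≤s z≤n)) m) ⟩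
  2 ^ m * 2 ^ m    ≡⟨ ^-distribʳ-* 2 2 m ⟨
  4 ^ m            ∎
  where open ≤-Reasoning

[1+K]^j*c≤[1+K]*K^j : ∀ K j c → j + c ≡ suc K → suc K ^ j * c ≤ suc K * K ^ j
[1+K]^j*c≤[1+K]*K^j K zero    c j+c≡1+K = ≤-reflexive (trans (+-identityʳ c) (trans j+c≡1+K (sym (*-identityʳ (suc K)))))
[1+K]^j*c≤[1+K]*K^j K (suc j) c j+c≡1+K = begin
  suc K ^ suc j * c           ≡⟨ x*y*z≡y*[x*z] (suc K) (suc K ^ j) c ⟩
  suc K ^ j * (suc K * c)     ≤⟨ *-monoʳ-≤ (suc K ^ j) [1+K]c≤K[1+c] ⟩
  suc K ^ j * (K * suc c)     ≡⟨ x*[y*z]≡y*[x*z] (suc K ^ j) K (suc c) ⟩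
  K * (suc K ^ j * suc c)     ≤⟨ *-monoʳ-≤ K ([1+K]^j*c≤[1+K]*K^j K j (suc c) (trans (+-suc j c) j+c≡1+K)) ⟩
  K * (suc K * K ^ j)         ≡⟨ x*[y*z]≡y*[x*z] K (suc K) (K ^ j) ⟩
  suc K * K ^ suc j           ∎
  where
  open ≤-Reasoning
  x*y*z≡y*[x*z] : ∀ x y z → x * y * z ≡ y * (x * z)
  x*y*z≡y*[x*z] = solve-∀
  x*[y*z]≡y*[x*z] : ∀ x y z → x * (y * z) ≡ y * (x * z)
  x*[y*z]≡y*[x*z] = solve-∀
  [1+K]c≤K[1+c] : suc K * c ≤ K * suc c
  [1+K]c≤K[1+c] = ≤-trans (+-monoˡ-≤ (K * c) (≤-pred (subst (suc c ≤_) j+c≡1+K (s≤s (m≤n+m c j)))))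
                          (≤-reflexive (sym (*-suc K c)))

[1+2a]^a≤2*[2a]^a : ∀ a → suc (2 * a) ^ a ≤ 2 * (2 * a) ^ a
[1+2a]^a≤2*[2a]^a a = *-cancelʳ-≤ _ _ (suc a) (begin
  suc (2 * a) ^ a * suc a        ≤⟨ [1+K]^j*c≤[1+K]*K^j (2 * a) a (suc a) (a+[1+a]≡1+2a a) ⟩
  suc (2 * a) * (2 * a) ^ a      ≤⟨ *-monoˡ-≤ ((2 * a) ^ a) (≤-trans (n≤1+n _) (≤-reflexive (sym (*-suc 2 a)))) ⟩
  2 * suc a * (2 * a) ^ a        ≡⟨ x*y*z≡x*z*y 2 (suc a) ((2 * a) ^ a) ⟩
  2 * (2 * a) ^ a * suc a        ∎)
  where
  open ≤-Reasoning
  a+[1+a]≡1+2a : ∀ a → a + suc a ≡ suc (2 * a)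
  a+[1+a]≡1+2a = solve-∀
  x*y*z≡x*z*y : ∀ x y z → x * y * z ≡ x * z * y
  x*y*z≡x*z*y = solve-∀

[1+2a]^[a*m]≤2^m*[2a]^[a*m] : ∀ a m → suc (2 * a) ^ (a * m) ≤ 2 ^ m * (2 * a) ^ (a * m)
[1+2a]^[a*m]≤2^m*[2a]^[a*m] a m = begin
  suc (2 * a) ^ (a * m)          ≡⟨ ^-*-assoc (suc (2 * a)) a m ⟨
  (suc (2 * a) ^ a) ^ m          ≤⟨ ^-monoˡ-≤ m ([1+2a]^a≤2*[2a]^a a) ⟩
  (2 * (2 * a) ^ a) ^ m          ≡⟨ ^-distribʳ-* 2 ((2 * a) ^ a) m ⟩
  2 ^ m * ((2 * a) ^ a) ^ m      ≡⟨ cong (2 ^ m *_) (^-*-assoc (2 * a) a m) ⟩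
  2 ^ m * (2 * a) ^ (a * m)      ∎
  where open ≤-Reasoning

^-reflects-< : ∀ b .{{_ : NonZero b}} {m n} → b ^ m < b ^ n → m < n
^-reflects-< b {m} {n} b^m<b^n = ≰⇒> (λ n≤m → <⇒≱ b^m<b^n (^-monoʳ-≤ b n≤m))

16^m≤k : ∀ {m n k} → 256 ^ m < n → n < suc k * suc k → 16 ^ m ≤ k
16^m≤k {m} {n} {k} 256^m<n n<[1+k]² = ≮⇒≥ λ k<16^m → <-irrefl refl (begin-strict
  n                    <⟨ n<[1+k]² ⟩
  suc k * suc k        ≤⟨ *-mono-≤ k<16^m k<16^m ⟩
  16 ^ m * 16 ^ m      ≡⟨ ^-distribʳ-* 16 16 m ⟨
  256 ^ m              <⟨ 256^m<n ⟩
  n                    ∎)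
  where open ≤-Reasoning

isqrt≤2k+1 : ∀ {s n₁ n₂ k} → s * s ≤ n₂ → n₂ ≤ 2 * n₁ → n₁ < suc k * suc k → s ≤ 2 * k + 1
isqrt≤2k+1 {s} {n₁} {n₂} {k} s²≤n₂ n₂≤2n₁ n₁<[1+k]² = ≤-pred (≰⇒> λ 2k+2≤s → <-irrefl refl (begin-strict
  s * s                                     ≤⟨ s²≤n₂ ⟩
  n₂                                        ≤⟨ n₂≤2n₁ ⟩
  2 * n₁                                    <⟨ *-monoʳ-< 2 n₁<[1+k]² ⟩
  2 * (suc k * suc k)                       ≤⟨ m≤m+n _ _ ⟩
  2 * (suc k * suc k) + 2 * (suc k * suc k) ≡⟨ square k ⟩
  suc (2 * k + 1) * suc (2 * k + 1)         ≤⟨ *-mono-≤ 2k+2≤s 2k+2≤s ⟩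
  s * s                                     ∎))
  where
  open ≤-Reasoning
  square : ∀ k → 2 * (suc k * suc k) + 2 * (suc k * suc k) ≡ suc (2 * k + 1) * suc (2 * k + 1)
  square = solve-∀
[1+s]²≤[s+3]*s : ∀ s → 1 ≤ s → suc s * suc s ≤ (s + 3) * s
[1+s]²≤[s+3]*s (suc s) _ = ≤-trans (m≤m+n _ s) (≤-reflexive (expand s))
  where
  expand : ∀ s → suc (suc s) * suc (suc s) + s ≡ (suc s + 3) * suc s
  expand = solve-∀

module Constants (p : ℕ) (1≤p : 1 ≤ p) where

  instance
    p≢0 : NonZero p
    p≢0 = >-nonZero 1≤p

  K : ℕ
  K = 16 * p

  M₀ : ℕ
  M₀ = 4096 * (p * p)

  -- p log₂ n ≤ threshold m whenever n ≤ 256 ^ (1 + m) = 2 ^ (8 (1 + m))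
  threshold : ℕ → ℕ
  threshold m = 8 * p * suc m

  threshold-valid : ∀ q n m → 0 < q → n ≤ 256 ^ suc m → n ^ p ≤ 2 ^ (q * threshold m)
  threshold-valid q n m 0<q n≤ = begin
    n ^ p                           ≤⟨ ^-monoˡ-≤ p n≤ ⟩
    (256 ^ suc m) ^ p               ≡⟨ cong (_^ p) (^-*-assoc 2 8 (suc m)) ⟩
    (2 ^ (8 * suc m)) ^ p           ≡⟨ ^-*-assoc 2 (8 * suc m) p ⟩
    2 ^ (8 * suc m * p)             ≤⟨ ^-monoʳ-≤ 2 (≤-trans (≤-reflexive (rearrange m p)) (*-monoˡ-≤ (threshold m) 0<q)) ⟩
    2 ^ (q * threshold m)           ∎
    where
    open ≤-Reasoning
    rearrange : ∀ m p → 8 * suc m * p ≡ 1 * (8 * p * suc m)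
    rearrange = solve-∀

  few-below : ∀ t₁ m s → s * K ^ threshold m < t₁ * suc K ^ threshold m → s < t₁ * 2 ^ suc m
  few-below t₁ m s small = *-cancelʳ-< (K ^ threshold m) s (t₁ * 2 ^ suc m) (begin-strict
    s * K ^ threshold m                         <⟨ small ⟩
    t₁ * suc K ^ threshold m                    ≤⟨ *-monoʳ-≤ t₁ ratio ⟩
    t₁ * (2 ^ suc m * K ^ threshold m)          ≡⟨ *-assoc t₁ (2 ^ suc m) _ ⟨
    t₁ * 2 ^ suc m * K ^ threshold m            ∎)
    where
    open ≤-Reasoning
    K≡2*8p : 2 * (8 * p) ≡ K
    K≡2*8p = sym (*-assoc 2 8 p)
    ratio : suc K ^ threshold m ≤ 2 ^ suc m * K ^ threshold m
    ratio = subst (λ k → suc k ^ threshold m ≤ 2 ^ suc m * k ^ threshold m) K≡2*8p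
                  ([1+2a]^[a*m]≤2^m*[2a]^[a*m] (8 * p) (suc m))

  threshold-small : ∀ n m → M₀ ≤ m → 256 ^ m < n → 16 * (suc K * threshold m) ≤ n
  threshold-small n m M₀≤m 256^m<n = begin
    16 * (suc K * threshold m)          ≡⟨ expand p m ⟩
    (2048 * (p * p) + 128 * p) * suc m  ≤⟨ c*[1+m]≤4^m _ m (≤-trans coefficient≤M₀ M₀≤m) ⟩
    4 ^ m                               ≤⟨ ^-monoˡ-≤ m (m≤m+n 4 252) ⟩
    256 ^ m                             ≤⟨ <⇒≤ 256^m<n ⟩
    n                                   ∎
    where
    open ≤-Reasoning
    expand : ∀ p m → 16 * (suc (16 * p) * (8 * p * suc m)) ≡ (2048 * (p * p) + 128 * p) * suc m
    expand = solve-∀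
    coefficient≤M₀ : 2048 * (p * p) + 128 * p ≤ M₀
    coefficient≤M₀ = ≤-trans (+-monoʳ-≤ (2048 * (p * p)) (*-mono-≤ (m≤m+n 128 1920) (m≤m*n p p)))
                             (≤-reflexive (double (p * p)))
      where
      double : ∀ x → 2048 * x + 2048 * x ≡ 4096 * x
      double = solve-∀

  bound-small : ∀ m₁ m₂ → M₀ ≤ suc m₁ → m₂ ≤ suc m₁ → 20 * (threshold m₁ * 2 ^ suc m₂) ≤ 16 ^ m₁
  bound-small m₁ m₂ M₀≤1+m₁ m₂≤1+m₁ = begin
    20 * (threshold m₁ * 2 ^ suc m₂)          ≤⟨ *-monoʳ-≤ 20 (*-monoʳ-≤ (threshold m₁) (^-monoʳ-≤ 2 (s≤s m₂≤1+m₁))) ⟩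
    20 * (threshold m₁ * (2 * (2 * 2 ^ m₁)))  ≡⟨ expand p m₁ (2 ^ m₁) ⟩
    640 * p * suc m₁ * 2 ^ m₁                 ≤⟨ *-monoˡ-≤ (2 ^ m₁) (c*[1+m]≤4^m (640 * p) m₁ 640p≤m₁) ⟩
    4 ^ m₁ * 2 ^ m₁                           ≡⟨ ^-distribʳ-* 4 2 m₁ ⟨
    8 ^ m₁                                    ≤⟨ ^-monoˡ-≤ m₁ (m≤m+n 8 8) ⟩
    16 ^ m₁                                   ∎
    where
    open ≤-Reasoning
    expand : ∀ p m x → 20 * (8 * p * suc m * (2 * (2 * x))) ≡ 640 * p * suc m * x
    expand = solve-∀
    640p≤m₁ : 640 * p ≤ m₁
    640p≤m₁ = ≤-pred (begin
      suc (640 * p)        ≤⟨ +-monoˡ-≤ (640 * p) 1≤p ⟩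
      p + 640 * p          ≤⟨ *-monoˡ-≤ p (m≤m+n 641 3455) ⟩
      4096 * p             ≤⟨ *-monoʳ-≤ 4096 (m≤m*n p p) ⟩
      M₀                   ≤⟨ M₀≤1+m₁ ⟩
      suc m₁               ∎)

-- if m < k then k² ≤ n₁ ≤ 10Bm + 6Bk < 16Bk ≤ k²
matching-size : ∀ {n₁ k m s B} → 1 ≤ B → 20 * B ≤ k → k * k ≤ n₁ →
                n₁ ≤ 2 * ((2 * (2 * B) + 1) * m) + (s + 3) * B → s ≤ 2 * k + 1 → k ≤ m
matching-size {n₁} {k} {m} {s} {B} 1≤B 20B≤k k²≤n₁ n₁≤ s≤2k+1 with k ≤? m
... | yes k≤m = k≤m
... | no  k≰m = ⊥-elim (<-irrefl refl (begin-strict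
  k * k                                          ≤⟨ k²≤n₁ ⟩
  n₁                                             ≤⟨ n₁≤ ⟩
  2 * ((2 * (2 * B) + 1) * m) + (s + 3) * B      ≤⟨ +-mono-≤ (*-monoʳ-≤ 2 (*-monoˡ-≤ m 4B+1≤5B)) (*-monoˡ-≤ B s+3≤6k) ⟩
  2 * (5 * B * m) + 6 * k * B                    <⟨ +-monoˡ-< (6 * k * B) (*-monoʳ-< 2 (*-monoʳ-< (5 * B) (≰⇒> k≰m))) ⟩
  2 * (5 * B * k) + 6 * k * B                    ≡⟨ collect B k ⟩
  16 * B * k                                     ≤⟨ *-monoˡ-≤ k (≤-trans (*-monoˡ-≤ B (m≤m+n 16 4)) 20B≤k) ⟩
  k * k                                          ∎))
  where
  open ≤-Reasoning
  instance
    5B≢0 : NonZero (5 * B)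
    5B≢0 = >-nonZero (≤-trans 1≤B (m≤n*m B 5))
  1≤k : 1 ≤ k
  1≤k = ≤-trans (≤-trans 1≤B (m≤n*m B 20)) 20B≤k
  4B+1≤5B : 2 * (2 * B) + 1 ≤ 5 * B
  4B+1≤5B = ≤-trans (+-monoʳ-≤ (2 * (2 * B)) 1≤B) (≤-reflexive (4B+B B))
    where
    4B+B : ∀ B → 2 * (2 * B) + B ≡ 5 * B
    4B+B = solve-∀
  s+3≤6k : s + 3 ≤ 6 * k
  s+3≤6k = begin
    s + 3             ≤⟨ +-monoˡ-≤ 3 s≤2k+1 ⟩
    2 * k + 1 + 3     ≡⟨ +-assoc (2 * k) 1 3 ⟩
    2 * k + 4         ≤⟨ +-monoʳ-≤ (2 * k) (*-monoʳ-≤ 4 1≤k) ⟩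
    2 * k + 4 * k     ≡⟨ 2k+4k k ⟩
    6 * k             ∎
    where
    2k+4k : ∀ k → 2 * k + 4 * k ≡ 6 * k
    2k+4k = solve-∀
  collect : ∀ B k → 2 * (5 * B * k) + 6 * k * B ≡ 16 * B * k
  collect = solve-∀

module _ (p q : ℕ) (0<q : 0 < q) (q<p : q < p) where

  1≤p : 1 ≤ p
  1≤p = ≤-trans 0<q (<⇒≤ q<p)

  open Constants p 1≤p

  ε⁻¹ : ℕ
  ε⁻¹ = 16 * (suc K * suc K)

  bracketed-pair-matching : ∀ {n₁ n₂} (G : BipGraph n₁ n₂) → BipRamsey G p q → n₂ ≤ 2 * n₁ → 256 ^ M₀ < n₂ →
    ∀ k → k * k ≤ n₁ → n₁ < suc k * suc k →
    (∃ λ m₁ → 256 ^ m₁ < n₁ × n₁ ≤ 256 ^ suc m₁) → (∃ λ m₂ → 256 ^ m₂ < n₂ × n₂ ≤ 256 ^ suc m₂) →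
    (∃ λ s → s * s ≤ n₂ × n₂ < suc s * suc s) → PairMatching G 1 ε⁻¹ k
  bracketed-pair-matching {n₁} {n₂} G ramsey n₂≤2n₁ nC<n₂ k k²≤n₁ n₁<[1+k]²
    (m₁ , 256^m₁<n₁ , n₁≤256^[1+m₁]) (m₂ , 256^m₂<n₂ , n₂≤256^[1+m₂]) (s , s²≤n₂ , n₂<[1+s]²) =
    matching k (matching-size {m = m} {s = s} {B = B} 1≤B 20B≤k k²≤n₁ n₁≤ (isqrt≤2k+1 {n₁ = n₁} {k = k} s²≤n₂ n₂≤2n₁ n₁<[1+k]²))
    where
    t₁ t₂ B : ℕ
    t₁ = threshold m₁
    t₂ = threshold m₂
    B = t₁ * 2 ^ suc m₂
    M₀≤m₂ : M₀ ≤ m₂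
    M₀≤m₂ = ≤-pred (^-reflects-< 256 {M₀} {suc m₂} (<-≤-trans nC<n₂ n₂≤256^[1+m₂]))
    m₂≤1+m₁ : m₂ ≤ suc m₁
    m₂≤1+m₁ = ≤-pred (^-reflects-< 256 {m₂} {suc (suc m₁)}
                (<-≤-trans 256^m₂<n₂ (≤-trans n₂≤2n₁ (*-mono-≤ (m≤m+n 2 254) n₁≤256^[1+m₁]))))
    1≤B : 1 ≤ B
    1≤B = *-mono-≤ {1} {t₁} {1} (*-mono-≤ {1} {8 * p} (*-mono-≤ {1} {8} (s≤s z≤n) 1≤p) (s≤s z≤n)) (m^n>0 2 (suc m₂))
    20B≤k : 20 * B ≤ k
    20B≤k = ≤-trans (bound-small m₁ m₂ (≤-trans M₀≤m₂ m₂≤1+m₁) m₂≤1+m₁) (16^m≤k {m₁} 256^m₁<n₁ n₁<[1+k]²)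
    1<n₂ : 1 < n₂
    1<n₂ = ≤-<-trans (m^n>0 256 M₀) nC<n₂
    1≤s : 1 ≤ s
    1≤s = ≮⇒≥ λ s<1 → <⇒≱ n₂<[1+s]² (subst (λ s → suc s * suc s ≤ n₂) (sym (n<1⇒n≡0 s<1)) (<⇒≤ 1<n₂))
    bicliques : BicliqueFree G t₁ t₂ × BicliqueFree (complement G) t₁ t₂
    bicliques = bipRamsey⇒bicliqueFree G {p} {q} ramsey
                  (threshold-valid q n₁ m₁ 0<q n₁≤256^[1+m₁]) (threshold-valid q n₂ m₂ 0<q n₂≤256^[1+m₂])
    matchings : ∃ λ m → n₁ ≤ 2 * ((2 * (2 * B) + 1) * m) + (s + 3) * B × (∀ k → k ≤ m → PairMatching G 1 ε⁻¹ k)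
    matchings = BicliqueFreeGraph.pair-matchings G K t₁ t₂ B (proj₁ bicliques) (proj₂ bicliques) (few-below t₁ m₂)
                  (threshold-small n₂ m₂ M₀≤m₂ 256^m₂<n₂)
                  s {{>-nonZero 1≤s}} s²≤n₂ (s + 3) (<-≤-trans n₂<[1+s]² ([1+s]²≤[s+3]*s s 1≤s))
    m : ℕ
    m = proj₁ matchings
    n₁≤ : n₁ ≤ 2 * ((2 * (2 * B) + 1) * m) + (s + 3) * B
    n₁≤ = proj₁ (proj₂ matchings)
    matching : ∀ k → k ≤ m → PairMatching G 1 ε⁻¹ k
    matching = proj₂ (proj₂ matchings)

  large-pair-matching : ∀ {n₁ n₂} (G : BipGraph n₁ n₂) → BipRamsey G p q → n₂ ≤ 2 * n₁ → 2 * 256 ^ M₀ ≤ n₂ →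
    ∀ k → k * k ≤ n₁ → n₁ < suc k * suc k → PairMatching G 1 ε⁻¹ k
  large-pair-matching {n₁} {n₂} G ramsey n₂≤2n₁ 2nC≤n₂ k k²≤n₁ n₁<[1+k]² =
    bracketed-pair-matching G ramsey n₂≤2n₁ nC<n₂ k k²≤n₁ n₁<[1+k]²
      (power-bracket 256 n₁ 1<256 (<-≤-trans 1<nC nC≤n₁))
      (power-bracket 256 n₂ 1<256 (<-trans 1<nC nC<n₂))
      (∃-isqrt n₂)
    where
    1<256 : 1 < 256
    1<256 = s≤s (s≤s z≤n)
    1<nC : 1 < 256 ^ M₀
    1<nC = ^-monoʳ-< 256 1<256 {0} {M₀} (*-mono-≤ {1} {4096} (s≤s z≤n) (*-mono-≤ 1≤p 1≤p))
    nC<n₂ : 256 ^ M₀ < n₂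
    nC<n₂ = <-≤-trans (m<m+n (256 ^ M₀) (≤-trans (<⇒≤ 1<nC) (m≤m+n _ 0))) 2nC≤n₂
    nC≤n₁ : 256 ^ M₀ ≤ n₁
    nC≤n₁ = *-cancelˡ-≤ 2 (≤-trans 2nC≤n₂ n₂≤2n₁)

lemma3p1 : (p q : ℕ) → 0 < q → q < p →
    Σ ℕ λ a → Σ ℕ λ b → Σ ℕ λ nC → 0 < a × 0 < b ×
      ((n₁ n₂ : ℕ) (G : BipGraph n₁ n₂) → BipRamsey G p q →
        n₂ ≤ 2 * n₁ → 2 * nC ≤ n₂ →
        (k : ℕ) → k * k ≤ n₁ → n₁ < suc k * suc k →
        PairStar G a b k ⊎ PairMatching G a b k)
lemma3p1 p q 0<q q<p = 1 , ε⁻¹ p q 0<q q<p , 256 ^ M₀ , s≤s z≤n , s≤s z≤n ,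
  λ n₁ n₂ G ramsey n₂≤2n₁ 2nC≤n₂ k k²≤n₁ n₁<[1+k]² →
    inj₂ (large-pair-matching p q 0<q q<p G ramsey n₂≤2n₁ 2nC≤n₂ k k²≤n₁ n₁<[1+k]²)
  where open Constants p (≤-trans 0<q (<⇒≤ q<p)) using (M₀)
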